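{- Let $q$ be a prime power with $q\equiv 1\pmod 4$, let $k$ be a divisor of $q-1$ with $3<k<q-1$ such that $(q-1)/k$ is even, and let $B$ be the subgroup of order $k$ of $\mathbb{F}_q^\times$. Then $(q,k)$ gives a $3$-design if and only if \[\sum_{\{x,y,z\}\in\binom{B}{3}}\chi\big((x-y)(y-z)(z-x)\big)=0,\] where $\binom{B}{3}$ is the set of $3$-element subsets of $B$.
   Context: $\mathrm{PSL}(2,q)$ acts on $\mathrm{PG}(1,q)=\mathbb{F}_q\cup\{\infty\}$ by linear fractional transformations. We say $(q,k)$ gives a $3$-design if the $\mathrm{PSL}(2,q)$-orbit $\{gB\}$ is the block set of a $3$-$(q+1,k,\lambda)$ design for some positive integer $\lambda$. $\chi$ is the quadratic residue character of $\mathbb{F}_q^\times$ ($\chi(a)=1$ iff $a$ is a nonzero square, else $-1$); the summand is well defined since $\chi(-1)=1$. -}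

module Defs where

open import Data.Nat using (ℕ; zero; suc; _<_)
open import Data.Fin using (Fin; zero; suc)
open import Data.Fin.Properties using (_≟_)
open import Data.Fin.Subset using (Subset; _∈_; _⊆_; inside; outside)
open import Data.Fin.Subset.Properties using (_∈?_; _⊆?_)
open import Data.Bool using (Bool; true; false; if_then_else_)
open import Data.Vec using (Vec; tabulate)
open import Data.Vec.Properties using (≡-dec)
import Data.Bool.Properties as BoolP
open import Data.List using (List; []; _∷_; allFin; filter; length; concatMap; map; deduplicate; foldr)
open import Data.List.Relation.Unary.Any using (any?)
open import Data.Integer using (ℤ; 0ℤ; 1ℤ; -1ℤ)
import Data.Integer as ℤ
open import Data.Product using (Σ; _×_; _,_; proj₁; ∃)
open import Relation.Binary.PropositionalEquality using (_≡_; _≢_)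
open import Relation.Nullary using (Dec; yes; no; ¬_; does)
open import Relation.Nullary.Decidable using (⌊_⌋; _×-dec_)
open import Algebra.Structures using (IsCommutativeRing)

-- A finite field of order q, with carrier Fin q and propositional
-- equality (so equality is decidable and the elements are enumerable).

record FiniteField (q : ℕ) : Set where
  field
    _+_ _*_ : Fin q → Fin q → Fin q
    -_      : Fin q → Fin q
    0# 1#   : Fin q
    isCommutativeRing : IsCommutativeRing _≡_ _+_ _*_ -_ 0# 1#
    0≢1     : 0# ≢ 1#
    inverse : ∀ x → x ≢ 0# → ∃ λ y → x * y ≡ 1#

  infixl 6 _+_ _-_
  infixl 7 _*_
  _-_ : Fin q → Fin q → Fin q
  x - y = x + (- y)

module FF {q : ℕ} (F : FiniteField q) where
  open FiniteField F

  elems : List (Fin q)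
  elems = allFin q

  -- multiplicative inverse, found by search (0 ↦ 0)
  inv : Fin q → Fin q
  inv x with filter (λ y → (x * y) ≟ 1#) elems
  ... | []    = 0#
  ... | y ∷ _ = y

  χ : Fin q → ℤ
  χ a with a ≟ 0#
  ... | yes _ = 0ℤ
  ... | no  _ = if ⌊ any? (λ y → (y * y) ≟ a) elems ⌋ then 1ℤ else -1ℤ

  -- The projective line PG(1,q): Fin (suc q), with zero = ∞ and
  -- suc x = the field element x.

  Point : Set
  Point = Fin (suc q)

  ∞ : Point
  ∞ = zero

  Mat : Set
  Mat = Fin q × Fin q × Fin q × Fin q

  SL2 : List Mat
  SL2 = filter (λ { (a , b , c , d) → (a * d - b * c) ≟ 1# })
          (concatMap (λ a → concatMap (λ b → concatMap (λ c → map (λ d → (a , b , c , d)) elems) elems) elems) elems)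

  act : Mat → Point → Point
  act (a , b , c , d) zero with c ≟ 0#
  ... | yes _ = ∞
  ... | no  _ = suc (a * inv c)
  act (a , b , c , d) (suc x) with (c * x + d) ≟ 0#
  ... | yes _ = ∞
  ... | no  _ = suc ((a * x + b) * inv (c * x + d))

  image : Mat → Subset q → Subset (suc q)
  image g B = tabulate λ p →
    if ⌊ any? (λ x → act g (suc x) ≟ p) (filter (_∈? B) elems) ⌋ then inside else outside

  -- the block set: the PSL(2,q)-orbit {gB} (as a set of distinct blocks).
  -- PSL(2,q) = SL(2,q)/{±I} acts through SL(2,q), so the orbit is the
  -- set of distinct images under SL(2,q).
  blocks : Subset q → List (Subset (suc q))
  blocks B = deduplicate (≡-dec BoolP._≟_) (map (λ g → image g B) SL2)

  triple : Point → Point → Point → Subset (suc q)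
  triple x y z = tabulate λ p →
    if ⌊ p ≟ x ⌋ then inside else if ⌊ p ≟ y ⌋ then inside else if ⌊ p ≟ z ⌋ then inside else outside

  countContaining : Subset q → Subset (suc q) → ℕ
  countContaining B T = length (filter (T ⊆?_) (blocks B))

  Gives3Design : Subset q → Set
  Gives3Design B = Σ ℕ λ λ′ → (0 < λ′) ×
    (∀ (x y z : Point) → x ≢ y → y ≢ z → x ≢ z → countContaining B (triple x y z) ≡ λ′)

  record IsSubgroupOfUnits (B : Subset q) : Set where
    field
      nonzero : ∀ x → x ∈ B → x ≢ 0#
      one∈    : 1# ∈ B
      mul∈    : ∀ x y → x ∈ B → y ∈ B → (x * y) ∈ B
      inv∈    : ∀ x → x ∈ B → ∃ λ y → (y ∈ B) × (x * y ≡ 1#)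

  -- Σ over 3-element subsets {x,y,z} ⊆ B (enumerated as x < y < z in the
  -- order of Fin q) of χ((x-y)(y-z)(z-x))
  tripleSum : Subset q → ℤ
  tripleSum B =
    foldr ℤ._+_ 0ℤ (concatMap (λ x → concatMap (λ y → map (λ z → χ ((x - y) * (y - z) * (z - x)))
          (filter (λ z → (z ∈? B) ×-dec (Data.Fin._<?_ y z)) elems))
          (filter (λ y → (y ∈? B) ×-dec (Data.Fin._<?_ x y)) elems))
          (filter (_∈? B) elems))

-- Write Δ(x,y,z) = (x − y)(y − z)(z − x) and, for distinct points t = (t₁,t₂,t₃) of PG(1,q),
-- let C_t be a matrix sending 0, 1, ∞ to t₁, t₂, t₃. The matrices sending an ordered triple b
-- of distinct elements of B to t are the nonzero multiples k·C_t·adj(C_b), of determinant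
-- k²·det(C_t)·Δ(b); hence exactly two or no elements of SL(2,q) do so, according as det(C_t)·Δ(b)
-- is a square or not. Counting pairs (g, b) gives
--   #{blocks through t} · |Stab(B)| = 2 · #{ordered b : det(C_t)·Δ(b) is a square}.
-- As q ≡ 1 (mod 4), −1 is a square and the square class of Δ depends only on the set {x,y,z},
-- so the right-hand side is 12 N⁺ or 12 N⁻ according as det(C_t) is a square or not, where N⁺
-- and N⁻ count the 3-subsets of B on which Δ is a square resp. a nonsquare. Both kinds of t
-- occur, so B gives a 3-design iff N⁺ = N⁻, i.e. iff the character sum N⁺ − N⁻ vanishes.

module Submission where

open import Defs
open import Data.Nat as Nat using (ℕ; zero; suc)
import Data.Nat.Properties as ℕP
open import Data.Nat.Divisibility using (_∣_; divides; ∣m+n∣m⇒∣n; ∣1⇒≡1)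
open import Data.Integer as ℤ using (ℤ; 0ℤ; 1ℤ; -1ℤ; -[1+_]; sign; _◃_)
import Data.Integer.Properties as ℤP
import Data.Integer.Solver as ℤSolver
open import Data.Sign as Sign using (Sign)
open import Data.Bool using (Bool; true; false; if_then_else_)
import Data.Bool.Properties as BoolP
open import Data.Maybe using (Maybe; just; nothing)
open import Data.Fin as Fin using (Fin; zero; suc)
open import Data.Fin.Properties using (_≟_; suc-injective; <-cmp; <-trans; <-irrefl; <-asym)
open import Data.Fin.Subset as Subset using (Subset; _⊆_; inside; outside)
open import Data.Fin.Subset.Properties using (_∈?_; _⊆?_; ⊆-antisym)
open import Data.Vec using (tabulate; []; _∷_; here; there)
open import Data.Vec.Properties as VecP using ([]=⇒lookup; lookup⇒[]=; lookup∘tabulate)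
open import Data.List as List using (List; []; _∷_; _++_; filter; allFin; length; map; concatMap; foldr)
import Data.List.Properties as ListP
open import Data.List.Membership.Propositional using (_∈_; find; lose)
open import Data.List.Membership.Propositional.Properties
  using (∈-filter⁺; ∈-filter⁻; ∈-allFin; ∈-map⁺; ∈-map⁻; ∈-concatMap⁺; ∈-concatMap⁻; ∈-deduplicate⁺; ∈-deduplicate⁻)
open import Data.List.Membership.Propositional.Properties.WithK using (unique∧set⇒bag)
open import Data.List.Relation.Binary.BagAndSetEquality using (∼bag⇒↭)
import Data.List.Relation.Binary.Permutation.Propositional.Properties as PermP
open import Data.List.Relation.Unary.Any using (here; there; any?; satisfied)
open import Data.List.Relation.Unary.All as All using ([]; _∷_)
open import Data.List.Relation.Unary.AllPairs using ([]; _∷_)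
open import Data.List.Relation.Unary.Unique.Propositional using (Unique)
import Data.List.Relation.Unary.Unique.Propositional.Properties as UniqueP
import Data.List.Relation.Unary.Unique.DecPropositional.Properties as DecUniqueP
open import Data.Product using (_×_; _,_; proj₁; proj₂; ∃)
import Data.Product.Properties as ProductP
open import Data.Sum using (_⊎_; inj₁; inj₂)
open import Data.Empty using (⊥-elim)
open import Data.Unit using (tt)
open import Function using (_∘_; _∋_; _⇔_; mk⇔; Equivalence)
open import Relation.Nullary using (Dec; yes; no; ¬_)
open import Relation.Nullary.Decidable using (⌊_⌋; ¬?; map′; _×-dec_; _⊎-dec_)
open import Relation.Unary using (Decidable)
open import Relation.Binary using (tri<; tri≈; tri>)
open import Relation.Binary.Definitions using (DecidableEquality)
open import Relation.Binary.PropositionalEquality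
open import Algebra.Bundles using (CommutativeRing)
open import Algebra.Structures using (IsCommutativeRing)
import Algebra.Properties.Ring as RingProperties
import Algebra.Properties.CommutativeSemigroup as CommutativeSemigroupProperties
import Algebra.Properties.Semiring.Mult.TCOptimised as SemiringMult
import Algebra.Solver.Ring.AlmostCommutativeRing as ACR
import Algebra.Solver.Ring as RingSolver

module Counting where

  open Nat using (_+_; _*_; _≤_; _<_)
  open CommutativeSemigroupProperties ℕP.+-commutativeSemigroup using () renaming (interchange to +-interchange)

  private variable
    A C : Set

  indicator : {P : Set} → Dec P → ℕ
  indicator (yes _) = 1
  indicator (no _)  = 0

  count : {P : A → Set} → Decidable P → List A → ℕ
  count P? xs = length (filter P? xs)

  ∑ : (A → ℕ) → List A → ℕ
  ∑ f []       = 0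
  ∑ f (x ∷ xs) = f x + ∑ f xs

  count-∷ : {P : A → Set} (P? : Decidable P) (x : A) (xs : List A) →
    count P? (x ∷ xs) ≡ indicator (P? x) + count P? xs
  count-∷ P? x xs with P? x
  ... | yes _ = refl
  ... | no _  = refl

  count≡∑ : {P : A → Set} (P? : Decidable P) (xs : List A) → count P? xs ≡ ∑ (indicator ∘ P?) xs
  count≡∑ P? []       = refl
  count≡∑ P? (x ∷ xs) = trans (count-∷ P? x xs) (cong (indicator (P? x) +_) (count≡∑ P? xs))

  ∑-++ : (f : A → ℕ) (xs ys : List A) → ∑ f (xs ++ ys) ≡ ∑ f xs + ∑ f ys
  ∑-++ f []       ys = refl
  ∑-++ f (x ∷ xs) ys = trans (cong (f x +_) (∑-++ f xs ys)) (sym (ℕP.+-assoc (f x) _ _))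

  ∑-concatMap : (f : C → ℕ) (g : A → List C) (xs : List A) → ∑ f (concatMap g xs) ≡ ∑ (∑ f ∘ g) xs
  ∑-concatMap f g []       = refl
  ∑-concatMap f g (x ∷ xs) = trans (∑-++ f (g x) (concatMap g xs)) (cong (∑ f (g x) +_) (∑-concatMap f g xs))

  ∑-map : (f : C → ℕ) (g : A → C) (xs : List A) → ∑ f (map g xs) ≡ ∑ (f ∘ g) xs
  ∑-map f g []       = refl
  ∑-map f g (x ∷ xs) = cong (f (g x) +_) (∑-map f g xs)

  ∑-cong : {f g : A → ℕ} (xs : List A) → (∀ x → x ∈ xs → f x ≡ g x) → ∑ f xs ≡ ∑ g xs
  ∑-cong []       h = refl
  ∑-cong (x ∷ xs) h = cong₂ _+_ (h x (here refl)) (∑-cong xs (λ y y∈ → h y (there y∈)))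

  ∑-0 : (xs : List A) → ∑ (λ _ → 0) xs ≡ 0
  ∑-0 []       = refl
  ∑-0 (x ∷ xs) = ∑-0 xs

  ∑-+ : (f g : A → ℕ) (xs : List A) → ∑ (λ x → f x + g x) xs ≡ ∑ f xs + ∑ g xs
  ∑-+ f g []       = refl
  ∑-+ f g (x ∷ xs) = trans (cong (f x + g x +_) (∑-+ f g xs)) (+-interchange (f x) (g x) (∑ f xs) (∑ g xs))

  ∑-*ʳ : (c : ℕ) (f : A → ℕ) (xs : List A) → ∑ (λ x → f x * c) xs ≡ ∑ f xs * c
  ∑-*ʳ c f []       = refl
  ∑-*ʳ c f (x ∷ xs) = trans (cong (f x * c +_) (∑-*ʳ c f xs)) (sym (ℕP.*-distribʳ-+ c (f x) (∑ f xs)))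

  ∑-comm : (R : A → C → ℕ) (xs : List A) (ys : List C) →
    ∑ (λ x → ∑ (R x) ys) xs ≡ ∑ (λ y → ∑ (λ x → R x y) xs) ys
  ∑-comm R []       ys = sym (∑-0 ys)
  ∑-comm R (x ∷ xs) ys = trans (cong (∑ (R x) ys +_) (∑-comm R xs ys)) (sym (∑-+ (R x) _ ys))

  count-map : {P : C → Set} (P? : Decidable P) (g : A → C) (xs : List A) →
    count P? (map g xs) ≡ count (P? ∘ g) xs
  count-map P? g xs = trans (count≡∑ P? (map g xs)) (trans (∑-map _ g xs) (sym (count≡∑ (P? ∘ g) xs)))

  count-concatMap : {P : C → Set} (P? : Decidable P) (g : A → List C) (xs : List A) →
    count P? (concatMap g xs) ≡ ∑ (count P? ∘ g) xs
  count-concatMap P? g xs = trans (count≡∑ P? (concatMap g xs))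
    (trans (∑-concatMap _ g xs) (∑-cong xs (λ x _ → sym (count≡∑ P? (g x)))))

  count-cong : {P Q : A → Set} (P? : Decidable P) (Q? : Decidable Q) (xs : List A) →
    (∀ x → x ∈ xs → P x ⇔ Q x) → count P? xs ≡ count Q? xs
  count-cong P? Q? xs P⇔Q = trans (count≡∑ P? xs) (trans (∑-cong xs same) (sym (count≡∑ Q? xs)))
    where
    same : ∀ x → x ∈ xs → indicator (P? x) ≡ indicator (Q? x)
    same x x∈ with P? x | Q? x
    ... | yes _ | yes _ = refl
    ... | no _  | no _  = refl
    ... | yes p | no ¬q = ⊥-elim (¬q (Equivalence.to (P⇔Q x x∈) p))
    ... | no ¬p | yes q = ⊥-elim (¬p (Equivalence.from (P⇔Q x x∈) q))

  count-none : {P : A → Set} (P? : Decidable P) (xs : List A) → (∀ x → x ∈ xs → ¬ P x) → count P? xs ≡ 0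
  count-none P? []       h = refl
  count-none P? (x ∷ xs) h with P? x
  ... | yes p = ⊥-elim (h x (here refl) p)
  ... | no _  = count-none P? xs (λ y y∈ → h y (there y∈))

  count-all : {P : A → Set} (P? : Decidable P) (xs : List A) → (∀ x → x ∈ xs → P x) → count P? xs ≡ length xs
  count-all P? []       h = refl
  count-all P? (x ∷ xs) h with P? x
  ... | yes _ = cong suc (count-all P? xs (λ y y∈ → h y (there y∈)))
  ... | no ¬p = ⊥-elim (¬p (h x (here refl)))

  count+count¬≡length : {P : A → Set} (P? : Decidable P) (xs : List A) →
    count P? xs + count (¬? ∘ P?) xs ≡ length xs
  count+count¬≡length P? []       = refl
  count+count¬≡length P? (x ∷ xs) with P? x
  ... | yes _ = cong suc (count+count¬≡length P? xs)
  ... | no _  = trans (ℕP.+-suc _ _) (cong suc (count+count¬≡length P? xs))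

  count-mono : {P Q : A → Set} (P? : Decidable P) (Q? : Decidable Q) (xs : List A) →
    (∀ x → x ∈ xs → P x → Q x) → count P? xs ≤ count Q? xs
  count-mono P? Q? []       h = Nat.z≤n
  count-mono P? Q? (y ∷ xs) h with P? y | Q? y
  ... | yes _  | yes _  = Nat.s≤s (count-mono P? Q? xs (λ z z∈ → h z (there z∈)))
  ... | yes py | no ¬qy = ⊥-elim (¬qy (h y (here refl) py))
  ... | no _   | yes _  = ℕP.m≤n⇒m≤1+n (count-mono P? Q? xs (λ z z∈ → h z (there z∈)))
  ... | no _   | no _   = count-mono P? Q? xs (λ z z∈ → h z (there z∈))

  count-≡-⊆⇒⊇ : {P Q : A → Set} (P? : Decidable P) (Q? : Decidable Q) (xs : List A) →
    (∀ x → x ∈ xs → P x → Q x) → count P? xs ≡ count Q? xs → ∀ x → x ∈ xs → Q x → P x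
  count-≡-⊆⇒⊇ P? Q? (y ∷ xs) P⊆Q eq x x∈ qx with P? y | Q? y | x∈
  ... | yes py | _      | here refl = py
  ... | no _   | no ¬qy | here refl = ⊥-elim (¬qy qx)
  ... | yes _  | yes _  | there x∈xs = count-≡-⊆⇒⊇ P? Q? xs (λ z z∈ → P⊆Q z (there z∈)) (ℕP.suc-injective eq) x x∈xs qx
  ... | no _   | no _   | there x∈xs = count-≡-⊆⇒⊇ P? Q? xs (λ z z∈ → P⊆Q z (there z∈)) eq x x∈xs qx
  ... | yes py | no ¬qy | _ = ⊥-elim (¬qy (P⊆Q y (here refl) py))
  ... | no _   | yes _  | _ = ⊥-elim (ℕP.<-irrefl eq (Nat.s≤s (count-mono P? Q? xs (λ z z∈ → P⊆Q z (there z∈)))))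

  count>0⇒∃ : {P : A → Set} (P? : Decidable P) (xs : List A) → 0 < count P? xs → ∃ λ x → x ∈ xs × P x
  count>0⇒∃ P? (x ∷ xs) pos with P? x
  ... | yes p = x , here refl , p
  ... | no _  = let (y , y∈ , py) = count>0⇒∃ P? xs pos in y , there y∈ , py

  ∃⇒count>0 : {P : A → Set} (P? : Decidable P) (xs : List A) {x : A} → x ∈ xs → P x → 0 < count P? xs
  ∃⇒count>0 P? (y ∷ xs) x∈ px with P? y | x∈
  ... | yes _ | _          = Nat.s≤s Nat.z≤n
  ... | no ¬p | here refl  = ⊥-elim (¬p px)
  ... | no _  | there x∈xs = ∃⇒count>0 P? xs x∈xs px

  count-singleton : {P : A → Set} (P? : Decidable P) (xs : List A) → Unique xs → (a : A) → a ∈ xs →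
    (∀ x → x ∈ xs → P x ⇔ x ≡ a) → count P? xs ≡ 1
  count-singleton P? (x ∷ xs) (x∉ ∷ u) a a∈ P⇔≡a with P? x | a∈
  ... | yes px | _ = cong suc (count-none P? xs λ y y∈ py →
          All.lookup x∉ y∈ (trans (Equivalence.to (P⇔≡a x (here refl)) px) (sym (Equivalence.to (P⇔≡a y (there y∈)) py))))
  ... | no ¬px | here refl  = ⊥-elim (¬px (Equivalence.from (P⇔≡a x (here refl)) refl))
  ... | no _   | there a∈xs = count-singleton P? xs u a a∈xs (λ y y∈ → P⇔≡a y (there y∈))

  count-≟ : (_≟_ : DecidableEquality A) (xs : List A) → Unique xs → (a : A) → a ∈ xs → count (_≟ a) xs ≡ 1
  count-≟ _≟_ xs u a a∈ = count-singleton (_≟ a) xs u a a∈ (λ _ _ → mk⇔ (λ e → e) (λ e → e))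

  count-pair : {P : A → Set} (P? : Decidable P) (_≟_ : DecidableEquality A) (xs : List A) → Unique xs →
    (a b : A) → a ∈ xs → b ∈ xs → a ≢ b → (∀ x → x ∈ xs → P x ⇔ (x ≡ a ⊎ x ≡ b)) → count P? xs ≡ 2
  count-pair P? _≟_ xs u a b a∈ b∈ a≢b P⇔ = begin
    count P? xs                                           ≡⟨ count-cong P? (λ x → (x ≟ a) ⊎-dec (x ≟ b)) xs P⇔ ⟩
    count (λ x → (x ≟ a) ⊎-dec (x ≟ b)) xs                ≡⟨ count≡∑ _ xs ⟩
    ∑ (λ x → indicator ((x ≟ a) ⊎-dec (x ≟ b))) xs        ≡⟨ ∑-cong xs (λ x _ → indicator-⊎ x) ⟩
    ∑ (λ x → indicator (x ≟ a) + indicator (x ≟ b)) xs    ≡⟨ ∑-+ _ _ xs ⟩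
    ∑ (indicator ∘ (_≟ a)) xs + ∑ (indicator ∘ (_≟ b)) xs ≡⟨ cong₂ _+_ (sym (count≡∑ (_≟ a) xs)) (sym (count≡∑ (_≟ b) xs)) ⟩
    count (_≟ a) xs + count (_≟ b) xs                     ≡⟨ cong₂ _+_ (count-≟ _≟_ xs u a a∈) (count-≟ _≟_ xs u b b∈) ⟩
    2                                                     ∎
    where
    open ≡-Reasoning
    indicator-⊎ : ∀ x → indicator ((x ≟ a) ⊎-dec (x ≟ b)) ≡ indicator (x ≟ a) + indicator (x ≟ b)
    indicator-⊎ x with x ≟ a | x ≟ b
    ... | yes refl | yes refl = ⊥-elim (a≢b refl)
    ... | yes _    | no _     = refl
    ... | no _     | yes _    = refl
    ... | no _     | no _     = refl

  count-sameElements : {P : A → Set} (P? : Decidable P) (xs ys : List A) → Unique xs → Unique ys →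
    (∀ x → x ∈ xs → x ∈ ys) → (∀ x → x ∈ ys → x ∈ xs) → count P? xs ≡ count P? ys
  count-sameElements P? xs ys ux uy xs⊆ys ys⊆xs =
    PermP.↭-length (PermP.filter-↭ P? (∼bag⇒↭ (unique∧set⇒bag ux uy (mk⇔ (xs⊆ys _) (ys⊆xs _)))))

  count-∘-bijection : {P : A → Set} (P? : Decidable P) (xs : List A) → Unique xs → (f : A → A) →
    (∀ {x y} → f x ≡ f y → x ≡ y) → (∀ x → x ∈ xs → f x ∈ xs) → (∀ y → y ∈ xs → ∃ λ x → x ∈ xs × f x ≡ y) →
    count (P? ∘ f) xs ≡ count P? xs
  count-∘-bijection P? xs u f f-injective maps-into onto = trans (sym (count-map P? f xs))
    (count-sameElements P? (map f xs) xs (UniqueP.map⁺ f-injective u) u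
      (λ y y∈ → let (x , x∈ , y≡fx) = ∈-map⁻ f y∈ in subst (_∈ xs) (sym y≡fx) (maps-into x x∈))
      (λ y y∈ → let (x , x∈ , fx≡y) = onto y y∈ in subst (_∈ map f xs) fx≡y (∈-map⁺ f x∈)))

  ∈⇒length>0 : ∀ {x : A} {xs} → x ∈ xs → 0 Nat.< length xs
  ∈⇒length>0 (here _)  = Nat.s≤s Nat.z≤n
  ∈⇒length>0 (there _) = Nat.s≤s Nat.z≤n

  three-distinct : (xs : List A) → 3 Nat.≤ length xs → Unique xs →
    ∃ λ x → ∃ λ y → ∃ λ z → x ∈ xs × y ∈ xs × z ∈ xs × x ≢ y × y ≢ z × x ≢ z
  three-distinct (x ∷ y ∷ z ∷ _) _ ((x≢y ∷ x≢z ∷ _) ∷ (y≢z ∷ _) ∷ _) =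
    x , y , z , here refl , there (here refl) , there (there (here refl)) , x≢y , y≢z , x≢z
  three-distinct (_ ∷ [])     (Nat.s≤s ()) _
  three-distinct (_ ∷ _ ∷ []) (Nat.s≤s (Nat.s≤s ())) _

  ∑-count-comm : {R : A → C → Set} (R? : ∀ x y → Dec (R x y)) (xs : List A) (ys : List C) →
    ∑ (λ x → count (R? x) ys) xs ≡ ∑ (λ y → count (λ x → R? x y) xs) ys
  ∑-count-comm R? xs ys = begin
    ∑ (λ x → count (R? x) ys) xs                 ≡⟨ ∑-cong xs (λ x _ → count≡∑ (R? x) ys) ⟩
    ∑ (λ x → ∑ (λ y → indicator (R? x y)) ys) xs ≡⟨ ∑-comm (λ x y → indicator (R? x y)) xs ys ⟩
    ∑ (λ y → ∑ (λ x → indicator (R? x y)) xs) ys ≡⟨ ∑-cong ys (λ y _ → sym (count≡∑ (λ x → R? x y) xs)) ⟩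
    ∑ (λ y → count (λ x → R? x y) xs) ys         ∎
    where open ≡-Reasoning

  module _ (_≟_ : DecidableEquality C) where

    count-∘-fibres : {P : C → Set} (P? : Decidable P) (f : A → C) (xs : List A) (ds : List C) → Unique ds →
      (∀ x → x ∈ xs → f x ∈ ds) →
      count (P? ∘ f) xs ≡ ∑ (λ d → indicator (P? d) * count (λ x → f x ≟ d) xs) ds
    count-∘-fibres {P = P} P? f xs ds ds-unique f∈ds = begin
      count (P? ∘ f) xs                                              ≡⟨ count≡∑ _ xs ⟩
      ∑ (indicator ∘ P? ∘ f) xs                                      ≡⟨ ∑-cong xs (λ x x∈ → sym (fibre-sum x x∈)) ⟩
      ∑ (λ x → ∑ (λ d → indicator (P? d) * indicator (f x ≟ d)) ds) xs ≡⟨ ∑-comm _ xs ds ⟩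
      ∑ (λ d → ∑ (λ x → indicator (P? d) * indicator (f x ≟ d)) xs) ds ≡⟨ ∑-cong ds (λ d _ → factor d) ⟩
      ∑ (λ d → indicator (P? d) * count (λ x → f x ≟ d) xs) ds       ∎
      where
      open ≡-Reasoning
      factor : ∀ d → ∑ (λ x → indicator (P? d) * indicator (f x ≟ d)) xs ≡ indicator (P? d) * count (λ x → f x ≟ d) xs
      factor d = begin
        ∑ (λ x → indicator (P? d) * indicator (f x ≟ d)) xs ≡⟨ ∑-cong xs (λ x _ → ℕP.*-comm (indicator (P? d)) _) ⟩
        ∑ (λ x → indicator (f x ≟ d) * indicator (P? d)) xs ≡⟨ ∑-*ʳ (indicator (P? d)) _ xs ⟩
        ∑ (λ x → indicator (f x ≟ d)) xs * indicator (P? d) ≡⟨ ℕP.*-comm _ (indicator (P? d)) ⟩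
        indicator (P? d) * ∑ (λ x → indicator (f x ≟ d)) xs ≡⟨ cong (indicator (P? d) *_) (sym (count≡∑ _ xs)) ⟩
        indicator (P? d) * count (λ x → f x ≟ d) xs         ∎
      only-at-fx : ∀ x d → indicator (P? d) * indicator (f x ≟ d) ≡ indicator (P? (f x)) * indicator (f x ≟ d)
      only-at-fx x d with f x ≟ d
      ... | yes refl = refl
      ... | no _     = trans (ℕP.*-zeroʳ (indicator (P? d))) (sym (ℕP.*-zeroʳ (indicator (P? (f x)))))
      fibre-sum : ∀ x → x ∈ xs → ∑ (λ d → indicator (P? d) * indicator (f x ≟ d)) ds ≡ indicator (P? (f x))
      fibre-sum x x∈ = begin
        ∑ (λ d → indicator (P? d) * indicator (f x ≟ d)) ds       ≡⟨ ∑-cong ds (λ d _ → only-at-fx x d) ⟩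
        ∑ (λ d → indicator (P? (f x)) * indicator (f x ≟ d)) ds   ≡⟨ ∑-cong ds (λ d _ → ℕP.*-comm (indicator (P? (f x))) _) ⟩
        ∑ (λ d → indicator (f x ≟ d) * indicator (P? (f x))) ds   ≡⟨ ∑-*ʳ _ _ ds ⟩
        ∑ (λ d → indicator (f x ≟ d)) ds * indicator (P? (f x))   ≡⟨ cong (_* indicator (P? (f x))) (sym (count≡∑ _ ds)) ⟩
        count (f x ≟_) ds * indicator (P? (f x))                  ≡⟨ cong (_* indicator (P? (f x))) one-fibre ⟩
        1 * indicator (P? (f x))                                  ≡⟨ ℕP.*-identityˡ _ ⟩
        indicator (P? (f x))                                      ∎
        where
        one-fibre : count (f x ≟_) ds ≡ 1
        one-fibre = count-singleton (f x ≟_) ds ds-unique (f x) (f∈ds x x∈) (λ _ _ → mk⇔ sym sym)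

    count-∘-constantFibres : {P : C → Set} (P? : Decidable P) (f : A → C) (xs : List A) (ds : List C) → Unique ds →
      (∀ x → x ∈ xs → f x ∈ ds) → (s : ℕ) → (∀ d → d ∈ ds → count (λ x → f x ≟ d) xs ≡ s) →
      count (P? ∘ f) xs ≡ count P? ds * s
    count-∘-constantFibres P? f xs ds ds-unique f∈ds s fibre≡s = begin
      count (P? ∘ f) xs                                        ≡⟨ count-∘-fibres P? f xs ds ds-unique f∈ds ⟩
      ∑ (λ d → indicator (P? d) * count (λ x → f x ≟ d) xs) ds ≡⟨ ∑-cong ds (λ d d∈ → cong (indicator (P? d) *_) (fibre≡s d d∈)) ⟩
      ∑ (λ d → indicator (P? d) * s) ds                        ≡⟨ ∑-*ʳ s _ ds ⟩
      ∑ (indicator ∘ P?) ds * s                                ≡⟨ cong (_* s) (sym (count≡∑ P? ds)) ⟩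
      count P? ds * s                                          ∎
      where open ≡-Reasoning

  Unique-concatMap : (f : A → List C) (xs : List A) → Unique xs → (∀ x → x ∈ xs → Unique (f x)) →
    (∀ {x x′ z} → x ∈ xs → x′ ∈ xs → z ∈ f x → z ∈ f x′ → x ≡ x′) → Unique (concatMap f xs)
  Unique-concatMap f []       _          _        _         = []
  Unique-concatMap f (x ∷ xs) (x∉ ∷ xs!) f-unique disjoint = UniqueP.++⁺ (f-unique x (here refl))
    (Unique-concatMap f xs xs! (λ y y∈ → f-unique y (there y∈)) (λ y∈ y′∈ → disjoint (there y∈) (there y′∈)))
    apart
    where
    apart : ∀ {z} → ¬ (z ∈ f x × z ∈ concatMap f xs)
    apart (z∈fx , z∈rest) with find (∈-concatMap⁻ f {xs = xs} z∈rest)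
    ... | y , y∈ , z∈fy = All.lookup x∉ y∈ (disjoint (here refl) (there y∈) z∈fx z∈fy)

  2∣n⇒2∤1+n : ∀ {n} → 2 ∣ n → ¬ 2 ∣ suc n
  2∣n⇒2∤1+n {n} 2∣n 2∣1+n with ∣1⇒≡1 (∣m+n∣m⇒∣n (subst (2 ∣_) (ℕP.+-comm 1 n) 2∣1+n) 2∣n)
  ... | ()

  -- A fixed-point-free involution swaps {x | x < σ x} with {x | σ x < x}.
  involution-even : ∀ {n} (σ : Fin n → Fin n) → (∀ x → σ (σ x) ≡ x) → (xs : List (Fin n)) → Unique xs →
    (∀ x → x ∈ xs → σ x ∈ xs) → (∀ x → x ∈ xs → σ x ≢ x) → 2 ∣ length xs
  involution-even σ σσ xs xs! closed fixpoint-free = divides (count below? xs) (begin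
    length xs                                   ≡⟨ sym (count+count¬≡length below? xs) ⟩
    count below? xs + count (¬? ∘ below?) xs    ≡⟨ cong (count below? xs +_) above≡below ⟩
    count below? xs + count below? xs           ≡⟨ cong (count below? xs +_) (sym (ℕP.+-identityʳ _)) ⟩
    2 * count below? xs                         ≡⟨ ℕP.*-comm 2 (count below? xs) ⟩
    count below? xs * 2                         ∎)
    where
    open ≡-Reasoning
    below? : ∀ x → Dec (x Fin.< σ x)
    below? x = x Fin.<? σ x
    σ-injective : ∀ {x y} → σ x ≡ σ y → x ≡ y
    σ-injective {x} {y} e = trans (sym (σσ x)) (trans (cong σ e) (σσ y))
    not-below⇔σ-below : ∀ x → x ∈ xs → (¬ x Fin.< σ x) ⇔ σ x Fin.< σ (σ x)
    not-below⇔σ-below x x∈ rewrite σσ x = mk⇔ to (λ σx<x x<σx → <-asym x<σx σx<x)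
      where
      to : ¬ (x Fin.< σ x) → σ x Fin.< x
      to ¬x<σx with <-cmp x (σ x)
      ... | tri< x<σx _ _ = ⊥-elim (¬x<σx x<σx)
      ... | tri≈ _ x≡σx _ = ⊥-elim (fixpoint-free x x∈ (sym x≡σx))
      ... | tri> _ _ σx<x = σx<x
    above≡below : count (¬? ∘ below?) xs ≡ count below? xs
    above≡below = trans (count-cong (¬? ∘ below?) (below? ∘ σ) xs not-below⇔σ-below)
      (count-∘-bijection below? xs xs! σ σ-injective closed (λ y y∈ → σ y , closed y y∈ , σσ y))

module SubsetFacts where

  open Counting
  open Subset using () renaming (_∈_ to _∈ˢ_)

  private variable n : ℕ

  ∈-tabulate⁻ : (f : Fin n → Bool) (p : Fin n) → p ∈ˢ tabulate f → f p ≡ true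
  ∈-tabulate⁻ f p p∈ = trans (sym (lookup∘tabulate f p)) ([]=⇒lookup p∈)

  ∈-tabulate⁺ : (f : Fin n → Bool) (p : Fin n) → f p ≡ true → p ∈ˢ tabulate f
  ∈-tabulate⁺ f p fp≡true = lookup⇒[]= p (tabulate f) (trans (lookup∘tabulate f p) fp≡true)

  if-inside⁻ : ∀ {P : Set} (P? : Dec P) → (if ⌊ P? ⌋ then inside else outside) ≡ true → P
  if-inside⁻ (yes p) _ = p

  if-inside⁺ : ∀ {P : Set} (P? : Dec P) → P → (if ⌊ P? ⌋ then inside else outside) ≡ true
  if-inside⁺ (yes _) _ = refl
  if-inside⁺ (no ¬p) p = ⊥-elim (¬p p)

  count-∈?-tail : ∀ {n} (b : Bool) (S : Subset n) → count (_∈? S) (allFin n) ≡ count (_∈? (b ∷ S)) (List.tabulate suc)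
  count-∈?-tail {n} b S = begin
    count (_∈? S) (allFin n)                    ≡⟨ count-cong (_∈? S) (λ i → suc i ∈? (b ∷ S)) (allFin n) (λ _ _ → mk⇔ there drop) ⟩
    count (λ i → suc i ∈? (b ∷ S)) (allFin n)   ≡⟨ sym (count-map (_∈? (b ∷ S)) suc (allFin n)) ⟩
    count (_∈? (b ∷ S)) (map suc (allFin n))    ≡⟨ cong (count (_∈? (b ∷ S))) (ListP.map-tabulate (λ i → i) suc) ⟩
    count (_∈? (b ∷ S)) (List.tabulate suc)     ∎
    where
    open ≡-Reasoning
    drop : ∀ {i} → suc i ∈ˢ (b ∷ S) → i ∈ˢ S
    drop (there i∈S) = i∈S

  ∣∣≡count : (S : Subset n) → Subset.∣ S ∣ ≡ count (_∈? S) (allFin n)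
  ∣∣≡count []          = refl
  ∣∣≡count (true ∷ S)  = cong suc (trans (∣∣≡count S) (count-∈?-tail true S))
  ∣∣≡count (false ∷ S) = trans (∣∣≡count S) (count-∈?-tail false S)

-- The ring solver of the library needs coefficients whose equality is decidable; the
-- elements of an abstract ring are not, so integers are used, via the initial map ℤ → R.
module IntegerCoefficientSolver {A : Set} {add mul : A → A → A} {neg : A → A} {0ᴬ 1ᴬ : A}
  (isCommutativeRing : IsCommutativeRing _≡_ add mul neg 0ᴬ 1ᴬ) where

  commutativeRing : CommutativeRing _ _
  commutativeRing = record { isCommutativeRing = isCommutativeRing }

  open CommutativeRing commutativeRing using (_+_; _*_; -_; _-_; 0#; 1#; ring; semiring; +-commutativeSemigroup; +-identityˡ; +-identityʳ; +-comm; -‿inverseʳ)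
  open RingProperties ring using (-0#≈0#; -‿involutive; -‿+-comm; -‿distribˡ-*; -‿distribʳ-*)
  open SemiringMult semiring using (×-homo-+; ×1-homo-*; 1+×) renaming (_×_ to _·_)
  open CommutativeSemigroupProperties +-commutativeSemigroup using (interchange)

  sgn : Sign → A → A
  sgn Sign.+ x = x
  sgn Sign.- x = - x

  ⟦_⟧ : ℤ → A
  ⟦ i ⟧ = sgn (sign i) (ℤ.∣ i ∣ · 1#)

  ⟦◃⟧ : ∀ s n → ⟦ s ◃ n ⟧ ≡ sgn s (n · 1#)
  ⟦◃⟧ Sign.+ zero    = refl
  ⟦◃⟧ Sign.- zero    = sym -0#≈0#
  ⟦◃⟧ Sign.+ (suc n) = refl
  ⟦◃⟧ Sign.- (suc n) = refl

  sgn-* : ∀ s t x y → sgn s x * sgn t y ≡ sgn (s Sign.* t) (x * y)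
  sgn-* Sign.+ Sign.+ x y = refl
  sgn-* Sign.+ Sign.- x y = sym (-‿distribʳ-* x y)
  sgn-* Sign.- Sign.+ x y = sym (-‿distribˡ-* x y)
  sgn-* Sign.- Sign.- x y = begin
    - x * - y     ≡⟨ sym (-‿distribˡ-* x (- y)) ⟩
    - (x * - y)   ≡⟨ cong -_ (sym (-‿distribʳ-* x y)) ⟩
    - - (x * y)   ≡⟨ -‿involutive (x * y) ⟩
    x * y         ∎
    where open ≡-Reasoning

  *-homo : ∀ i j → ⟦ i ℤ.* j ⟧ ≡ ⟦ i ⟧ * ⟦ j ⟧
  *-homo i j = begin
    ⟦ sign i Sign.* sign j ◃ ℤ.∣ i ∣ Nat.* ℤ.∣ j ∣ ⟧               ≡⟨ ⟦◃⟧ (sign i Sign.* sign j) (ℤ.∣ i ∣ Nat.* ℤ.∣ j ∣) ⟩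
    sgn (sign i Sign.* sign j) ((ℤ.∣ i ∣ Nat.* ℤ.∣ j ∣) · 1#)       ≡⟨ cong (sgn (sign i Sign.* sign j)) (×1-homo-* ℤ.∣ i ∣ ℤ.∣ j ∣) ⟩
    sgn (sign i Sign.* sign j) ((ℤ.∣ i ∣ · 1#) * (ℤ.∣ j ∣ · 1#))    ≡⟨ sym (sgn-* (sign i) (sign j) (ℤ.∣ i ∣ · 1#) (ℤ.∣ j ∣ · 1#)) ⟩
    ⟦ i ⟧ * ⟦ j ⟧                                               ∎
    where open ≡-Reasoning

  1+x-[1+y]≡x-y : ∀ x y → (1# + x) - (1# + y) ≡ x - y
  1+x-[1+y]≡x-y x y = begin
    (1# + x) + - (1# + y)    ≡⟨ cong ((1# + x) +_) (sym (-‿+-comm 1# y)) ⟩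
    (1# + x) + (- 1# + - y)  ≡⟨ interchange 1# x (- 1#) (- y) ⟩
    (1# + - 1#) + (x - y)    ≡⟨ cong (_+ (x - y)) (-‿inverseʳ 1#) ⟩
    0# + (x - y)             ≡⟨ +-identityˡ (x - y) ⟩
    x - y                    ∎
    where open ≡-Reasoning

  ⊖-homo : ∀ m n → ⟦ m ℤ.⊖ n ⟧ ≡ (m · 1#) - (n · 1#)
  ⊖-homo m       zero    = sym (trans (cong ((m · 1#) +_) -0#≈0#) (+-identityʳ _))
  ⊖-homo zero    (suc n) = sym (+-identityˡ _)
  ⊖-homo (suc m) (suc n) = begin
    ⟦ suc m ℤ.⊖ suc n ⟧                  ≡⟨ cong ⟦_⟧ (ℤP.[1+m]⊖[1+n]≡m⊖n m n) ⟩
    ⟦ m ℤ.⊖ n ⟧                          ≡⟨ ⊖-homo m n ⟩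
    (m · 1#) - (n · 1#)                  ≡⟨ sym (1+x-[1+y]≡x-y _ _) ⟩
    (1# + m · 1#) - (1# + n · 1#)        ≡⟨ sym (cong₂ _-_ (1+× m 1#) (1+× n 1#)) ⟩
    (suc m · 1#) - (suc n · 1#)          ∎
    where open ≡-Reasoning

  +-homo : ∀ i j → ⟦ i ℤ.+ j ⟧ ≡ ⟦ i ⟧ + ⟦ j ⟧
  +-homo -[1+ m ] -[1+ n ] = begin
    - (suc (suc (m Nat.+ n)) · 1#)        ≡⟨ cong (λ k → - (suc k · 1#)) (sym (ℕP.+-suc m n)) ⟩
    - ((suc m Nat.+ suc n) · 1#)          ≡⟨ cong -_ (×-homo-+ 1# (suc m) (suc n)) ⟩
    - ((suc m · 1#) + (suc n · 1#))       ≡⟨ sym (-‿+-comm _ _) ⟩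
    - (suc m · 1#) + - (suc n · 1#)       ∎
    where open ≡-Reasoning
  +-homo -[1+ m ] (ℤ.+ n)  = trans (⊖-homo n (suc m)) (+-comm _ _)
  +-homo (ℤ.+ m)  -[1+ n ] = ⊖-homo m (suc n)
  +-homo (ℤ.+ m)  (ℤ.+ n)  = ×-homo-+ 1# m n

  -‿homo : ∀ i → ⟦ ℤ.- i ⟧ ≡ - ⟦ i ⟧
  -‿homo -[1+ n ]      = sym (-‿involutive _)
  -‿homo (ℤ.+ zero)    = sym -0#≈0#
  -‿homo (ℤ.+ (suc n)) = refl

  almostCommutativeRing : ACR.AlmostCommutativeRing _ _
  almostCommutativeRing = ACR.fromCommutativeRing commutativeRing

  homomorphism : ℤ.+-*-rawRing ACR.-Raw-AlmostCommutative⟶ almostCommutativeRing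
  homomorphism = record
    { ⟦_⟧ = ⟦_⟧ ; +-homo = +-homo ; *-homo = *-homo ; -‿homo = -‿homo
    ; 0-homo = refl ; 1-homo = refl }

  ⟦⟧-≟ : ∀ i j → Maybe (⟦ i ⟧ ≡ ⟦ j ⟧)
  ⟦⟧-≟ i j with i ℤ.≟ j
  ... | yes refl = just refl
  ... | no _     = nothing

  open RingSolver ℤ.+-*-rawRing almostCommutativeRing homomorphism ⟦⟧-≟ public
    using (solve; Polynomial; con; _:+_; _:*_; :-_; _:-_; _:=_)

  :0 :1 : ∀ {n} → Polynomial n
  :0 = con 0ℤ
  :1 = con 1ℤ

module IntegerIdentities where

  open ℤSolver.+-*-Solver

  1+[m-n]≡[1+m]-n : ∀ m n → 1ℤ ℤ.+ (m ℤ.- n) ≡ (1ℤ ℤ.+ m) ℤ.- n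
  1+[m-n]≡[1+m]-n = solve 2 (λ m n → con 1ℤ :+ (m :- n) := (con 1ℤ :+ m) :- n) refl

  -1+[m-n]≡m-[1+n] : ∀ m n → -1ℤ ℤ.+ (m ℤ.- n) ≡ m ℤ.- (1ℤ ℤ.+ n)
  -1+[m-n]≡m-[1+n] = solve 2 (λ m n → con -1ℤ :+ (m :- n) := m :- (con 1ℤ :+ n)) refl

module FieldArithmetic {q : ℕ} (F : FiniteField q) where

  open FiniteField F public
  open FF F public
  open IntegerCoefficientSolver isCommutativeRing public using (solve; _:+_; _:*_; :-_; _:-_; _:=_; :0; :1)
  open IsCommutativeRing isCommutativeRing public using (*-comm; *-assoc; *-identityˡ; *-identityʳ; zeroˡ; zeroʳ)

  1≢0 : 1# ≢ 0#
  1≢0 e = 0≢1 (sym e)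

  *-inverseʳ : ∀ x → x ≢ 0# → x * inv x ≡ 1#
  *-inverseʳ x x≢0 with filter (λ y → (x * y) ≟ 1#) elems in eq
  ... | y ∷ _ = proj₂ (∈-filter⁻ (λ y → (x * y) ≟ 1#) {xs = elems} (subst (y ∈_) (sym eq) (here refl)))
  ... | []    with inverse x x≢0
  ...   | y , xy≡1 with subst (y ∈_) eq (∈-filter⁺ (λ y → (x * y) ≟ 1#) (∈-allFin y) xy≡1)
  ...     | ()

  *-inverseˡ : ∀ x → x ≢ 0# → inv x * x ≡ 1#
  *-inverseˡ x x≢0 = trans (*-comm _ _) (*-inverseʳ x x≢0)

  inv-0 : inv 0# ≡ 0#
  inv-0 with filter (λ y → (0# * y) ≟ 1#) elems in eq
  ... | []    = refl
  ... | y ∷ _ = ⊥-elim (0≢1 (trans (sym (zeroˡ y))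
       (proj₂ (∈-filter⁻ (λ y → (0# * y) ≟ 1#) {xs = elems} (subst (y ∈_) (sym eq) (here refl))))))

  x*y≡0⇒x≡0 : ∀ x y → y ≢ 0# → x * y ≡ 0# → x ≡ 0#
  x*y≡0⇒x≡0 x y y≢0 xy≡0 = begin
    x                 ≡⟨ sym (*-identityʳ x) ⟩
    x * 1#            ≡⟨ cong (x *_) (sym (*-inverseʳ y y≢0)) ⟩
    x * (y * inv y)   ≡⟨ sym (*-assoc x y (inv y)) ⟩
    (x * y) * inv y   ≡⟨ cong (_* inv y) xy≡0 ⟩
    0# * inv y        ≡⟨ zeroˡ (inv y) ⟩
    0#                ∎
    where open ≡-Reasoning

  x*y≡0⇒y≡0 : ∀ x y → x ≢ 0# → x * y ≡ 0# → y ≡ 0#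
  x*y≡0⇒y≡0 x y x≢0 xy≡0 = x*y≡0⇒x≡0 y x x≢0 (trans (*-comm y x) xy≡0)

  *-≢0 : ∀ x y → x ≢ 0# → y ≢ 0# → x * y ≢ 0#
  *-≢0 x y x≢0 y≢0 xy≡0 = x≢0 (x*y≡0⇒x≡0 x y y≢0 xy≡0)

  inv-≢0 : ∀ x → x ≢ 0# → inv x ≢ 0#
  inv-≢0 x x≢0 inv≡0 = 1≢0 (trans (sym (*-inverseʳ x x≢0)) (trans (cong (x *_) inv≡0) (zeroʳ x)))

  -‿≢0 : ∀ x → x ≢ 0# → - x ≢ 0#
  -‿≢0 x x≢0 -x≡0 = x≢0 (trans (solve 1 (λ x → x := :- (:- x)) refl x) (trans (cong -_ -x≡0) (solve 0 (:- :0 := :0) refl)))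

  x-y≡0⇒x≡y : ∀ x y → x - y ≡ 0# → x ≡ y
  x-y≡0⇒x≡y x y x-y≡0 = begin
    x             ≡⟨ solve 2 (λ x y → x := (x :- y) :+ y) refl x y ⟩
    (x - y) + y   ≡⟨ cong (_+ y) x-y≡0 ⟩
    0# + y        ≡⟨ solve 1 (λ y → :0 :+ y := y) refl y ⟩
    y             ∎
    where open ≡-Reasoning

  x≢y⇒x-y≢0 : ∀ x y → x ≢ y → x - y ≢ 0#
  x≢y⇒x-y≢0 x y x≢y x-y≡0 = x≢y (x-y≡0⇒x≡y x y x-y≡0)

  *-cancelˡ : ∀ x y z → x ≢ 0# → x * y ≡ x * z → y ≡ z
  *-cancelˡ x y z x≢0 xy≡xz = x-y≡0⇒x≡y y z (x*y≡0⇒y≡0 x (y - z) x≢0 (begin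
    x * (y - z)       ≡⟨ solve 3 (λ x y z → x :* (y :- z) := x :* y :- x :* z) refl x y z ⟩
    x * y - x * z     ≡⟨ cong (_- x * z) xy≡xz ⟩
    x * z - x * z     ≡⟨ solve 2 (λ x z → x :* z :- x :* z := :0) refl x z ⟩
    0#                ∎))
    where open ≡-Reasoning

  inv-unique : ∀ x y → x ≢ 0# → x * y ≡ 1# → y ≡ inv x
  inv-unique x y x≢0 xy≡1 = *-cancelˡ x y (inv x) x≢0 (trans xy≡1 (sym (*-inverseʳ x x≢0)))

  inv-involutive : ∀ x → inv (inv x) ≡ x
  inv-involutive x with x ≟ 0#
  ... | yes refl = trans (cong inv inv-0) inv-0
  ... | no x≢0   = sym (inv-unique (inv x) x (inv-≢0 x x≢0) (*-inverseˡ x x≢0))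

  a/b≡c/d⇒ad≡cb : ∀ a b c d → b ≢ 0# → d ≢ 0# → a * inv b ≡ c * inv d → a * d ≡ c * b
  a/b≡c/d⇒ad≡cb a b c d b≢0 d≢0 a/b≡c/d = begin
    a * d                       ≡⟨ solve 4 (λ a b d b⁻¹ → a :* d := (a :* b⁻¹) :* (b :* d) :+ a :* d :* (:1 :- b :* b⁻¹)) refl a b d (inv b) ⟩
    (a * inv b) * (b * d) + a * d * (1# - b * inv b)
                                ≡⟨ cong₂ (λ u v → u * (b * d) + a * d * (1# - v)) a/b≡c/d (*-inverseʳ b b≢0) ⟩
    (c * inv d) * (b * d) + a * d * (1# - 1#)
                                ≡⟨ solve 5 (λ a b c d d⁻¹ → (c :* d⁻¹) :* (b :* d) :+ a :* d :* (:1 :- :1) := c :* b :* (d :* d⁻¹)) refl a b c d (inv d) ⟩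
    c * b * (d * inv d)         ≡⟨ cong (c * b *_) (*-inverseʳ d d≢0) ⟩
    c * b * 1#                  ≡⟨ *-identityʳ _ ⟩
    c * b                       ∎
    where open ≡-Reasoning

  ad≡cb⇒a/b≡c/d : ∀ a b c d → b ≢ 0# → d ≢ 0# → a * d ≡ c * b → a * inv b ≡ c * inv d
  ad≡cb⇒a/b≡c/d a b c d b≢0 d≢0 ad≡cb = *-cancelˡ (b * d) _ _ (*-≢0 b d b≢0 d≢0) (begin
    b * d * (a * inv b)     ≡⟨ solve 4 (λ a b d b⁻¹ → b :* d :* (a :* b⁻¹) := (a :* d) :* (b :* b⁻¹)) refl a b d (inv b) ⟩
    (a * d) * (b * inv b)   ≡⟨ cong₂ _*_ ad≡cb (*-inverseʳ b b≢0) ⟩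
    (c * b) * 1#            ≡⟨ cong ((c * b) *_) (sym (*-inverseʳ d d≢0)) ⟩
    (c * b) * (d * inv d)   ≡⟨ solve 4 (λ b c d d⁻¹ → (c :* b) :* (d :* d⁻¹) := b :* d :* (c :* d⁻¹)) refl b c d (inv d) ⟩
    b * d * (c * inv d)     ∎)
    where open ≡-Reasoning

module ProjectiveLine {q : ℕ} (F : FiniteField q) where

  open FieldArithmetic F

  point : Fin q → Fin q → Point
  point u v with v ≟ 0#
  ... | yes _ = ∞
  ... | no _  = suc (u * inv v)

  NonZeroPair : Fin q → Fin q → Set
  NonZeroPair u v = u ≡ 0# → v ≢ 0#

  point-∞ : ∀ u v → v ≡ 0# → point u v ≡ ∞
  point-∞ u v v≡0 with v ≟ 0#
  ... | yes _  = refl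
  ... | no v≢0 = ⊥-elim (v≢0 v≡0)

  point-suc : ∀ u v → v ≢ 0# → point u v ≡ suc (u * inv v)
  point-suc u v v≢0 with v ≟ 0#
  ... | yes v≡0 = ⊥-elim (v≢0 v≡0)
  ... | no _    = refl

  point-scale : ∀ k u v → k ≢ 0# → point (k * u) (k * v) ≡ point u v
  point-scale k u v k≢0 with v ≟ 0#
  ... | yes v≡0 = point-∞ _ _ (trans (cong (k *_) v≡0) (zeroʳ k))
  ... | no v≢0  = trans (point-suc _ _ (*-≢0 k v k≢0 v≢0)) (cong suc
        (ad≡cb⇒a/b≡c/d _ _ _ _ (*-≢0 k v k≢0 v≢0) v≢0 (solve 3 (λ k u v → k :* u :* v := u :* (k :* v)) refl k u v)))

  point-injective : ∀ u v u′ v′ → point u v ≡ point u′ v′ → u * v′ ≡ u′ * v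
  point-injective u v u′ v′ eq with v ≟ 0# | v′ ≟ 0#
  ... | yes refl | yes refl = solve 2 (λ u u′ → u :* :0 := u′ :* :0) refl u u′
  ... | no v≢0   | no v′≢0  = a/b≡c/d⇒ad≡cb u v u′ v′ v≢0 v′≢0 (suc-injective eq)
  point-injective u v u′ v′ () | yes _ | no _
  point-injective u v u′ v′ () | no _  | yes _

  point-≡ : ∀ u v u′ v′ → NonZeroPair u v → NonZeroPair u′ v′ → u * v′ ≡ u′ * v → point u v ≡ point u′ v′
  point-≡ u v u′ v′ nz nz′ uv′≡u′v with v ≟ 0# | v′ ≟ 0#
  ... | yes _    | yes _   = refl
  ... | no v≢0   | no v′≢0 = cong suc (ad≡cb⇒a/b≡c/d u v u′ v′ v≢0 v′≢0 uv′≡u′v)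
  ... | yes refl | no v′≢0 = ⊥-elim (nz (x*y≡0⇒x≡0 u v′ v′≢0 (trans uv′≡u′v (zeroʳ u′))) refl)
  ... | no v≢0   | yes refl = ⊥-elim (nz′ (x*y≡0⇒x≡0 u′ v v≢0 (trans (sym uv′≡u′v) (zeroʳ u))) refl)

  hom₁ hom₂ : Point → Fin q
  hom₁ zero    = 1#
  hom₁ (suc x) = x
  hom₂ zero    = 0#
  hom₂ (suc x) = 1#

  NonZeroPair-hom : ∀ p → NonZeroPair (hom₁ p) (hom₂ p)
  NonZeroPair-hom zero    1≡0 _ = 1≢0 1≡0
  NonZeroPair-hom (suc x) _     = 1≢0

  point-hom : ∀ p → point (hom₁ p) (hom₂ p) ≡ p
  point-hom zero    = point-∞ 1# 0# refl
  point-hom (suc x) = trans (point-suc x 1# 1≢0) (cong suc (trans (cong (x *_) inv-1) (*-identityʳ x)))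
    where
    inv-1 : inv 1# ≡ 1#
    inv-1 = sym (inv-unique 1# 1# 1≢0 (*-identityʳ 1#))

  δ : Point → Point → Fin q
  δ p p′ = hom₁ p * hom₂ p′ - hom₁ p′ * hom₂ p

  δ-≢0 : ∀ p p′ → p ≢ p′ → δ p p′ ≢ 0#
  δ-≢0 p p′ p≢p′ δ≡0 = p≢p′ (begin
    p                           ≡⟨ sym (point-hom p) ⟩
    point (hom₁ p) (hom₂ p)     ≡⟨ point-≡ _ _ _ _ (NonZeroPair-hom p) (NonZeroPair-hom p′) (x-y≡0⇒x≡y _ _ δ≡0) ⟩
    point (hom₁ p′) (hom₂ p′)   ≡⟨ point-hom p′ ⟩
    p′                          ∎)
    where open ≡-Reasoning

  apply₁ apply₂ : Mat → Fin q → Fin q → Fin q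
  apply₁ (a , b , c , d) u v = a * u + b * v
  apply₂ (a , b , c , d) u v = c * u + d * v

  act-∞ : ∀ a b c d → act (a , b , c , d) ∞ ≡ point a c
  act-∞ a b c d with c ≟ 0#
  ... | yes _ = refl
  ... | no _  = refl

  act-suc : ∀ a b c d x → act (a , b , c , d) (suc x) ≡ point (a * x + b) (c * x + d)
  act-suc a b c d x with c * x + d ≟ 0#
  ... | yes _ = refl
  ... | no _  = refl

  act-point : ∀ m u v → NonZeroPair u v → act m (point u v) ≡ point (apply₁ m u v) (apply₂ m u v)
  act-point (a , b , c , d) u v nz with v ≟ 0#
  ... | yes refl = begin
    act (a , b , c , d) ∞                 ≡⟨ act-∞ a b c d ⟩
    point a c                             ≡⟨ sym (point-scale u a c u≢0) ⟩
    point (u * a) (u * c)                 ≡⟨ cong₂ point (solve 3 (λ u a b → u :* a := a :* u :+ b :* :0) refl u a b)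
                                                         (solve 3 (λ u c d → u :* c := c :* u :+ d :* :0) refl u c d) ⟩
    point (a * u + b * 0#) (c * u + d * 0#) ∎
    where
    open ≡-Reasoning
    u≢0 : u ≢ 0#
    u≢0 u≡0 = nz u≡0 refl
  ... | no v≢0 = begin
    act (a , b , c , d) (suc x)                   ≡⟨ act-suc a b c d x ⟩
    point (a * x + b) (c * x + d)                 ≡⟨ sym (point-scale v _ _ v≢0) ⟩
    point (v * (a * x + b)) (v * (c * x + d))     ≡⟨ cong₂ point (clear a b) (clear c d) ⟩
    point (a * u + b * v) (c * u + d * v)         ∎
    where
    open ≡-Reasoning
    x = u * inv v
    clear : ∀ s t → v * (s * x + t) ≡ s * u + t * v
    clear s t = begin
      v * (s * (u * inv v) + t)          ≡⟨ solve 5 (λ v s u v⁻¹ t → v :* (s :* (u :* v⁻¹) :+ t) := s :* u :* (v :* v⁻¹) :+ t :* v) refl v s u (inv v) t ⟩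
      s * u * (v * inv v) + t * v        ≡⟨ cong (λ w → s * u * w + t * v) (*-inverseʳ v v≢0) ⟩
      s * u * 1# + t * v                 ≡⟨ cong (_+ t * v) (*-identityʳ (s * u)) ⟩
      s * u + t * v                      ∎

module Matrices {q : ℕ} (F : FiniteField q) where

  open FieldArithmetic F
  open ProjectiveLine F

  infixl 7 _⊙_

  _⊙_ : Mat → Mat → Mat
  (a , b , c , d) ⊙ (e , f , g , h) = (a * e + b * g , a * f + b * h , c * e + d * g , c * f + d * h)

  adj : Mat → Mat
  adj (a , b , c , d) = (d , - b , - c , a)

  det : Mat → Fin q
  det (a , b , c , d) = a * d - b * c

  scale : Fin q → Mat → Mat
  scale k (a , b , c , d) = (k * a , k * b , k * c , k * d)

  scalar : Fin q → Mat
  scalar k = (k , 0# , 0# , k)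

  mat-≡ : ∀ {a b c d a′ b′ c′ d′ : Fin q} → a ≡ a′ → b ≡ b′ → c ≡ c′ → d ≡ d′ → (Mat ∋ (a , b , c , d)) ≡ (a′ , b′ , c′ , d′)
  mat-≡ refl refl refl refl = refl

  ⊙-assoc : ∀ m n r → m ⊙ n ⊙ r ≡ m ⊙ (n ⊙ r)
  ⊙-assoc (a , b , c , d) (e , f , g , h) (i , j , k , l) = mat-≡ (entry a b e f g h i k) (entry a b e f g h j l)
                                                                   (entry c d e f g h i k) (entry c d e f g h j l)
    where
    entry : ∀ a b e f g h i k → (a * e + b * g) * i + (a * f + b * h) * k ≡ a * (e * i + f * k) + b * (g * i + h * k)
    entry = solve 8 (λ a b e f g h i k → (a :* e :+ b :* g) :* i :+ (a :* f :+ b :* h) :* k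
                                         := a :* (e :* i :+ f :* k) :+ b :* (g :* i :+ h :* k)) refl

  scalar-⊙ : ∀ k m → scalar k ⊙ m ≡ scale k m
  scalar-⊙ k (a , b , c , d) = mat-≡ (left k a c) (left k b d) (right k a c) (right k b d)
    where
    left : ∀ k x y → k * x + 0# * y ≡ k * x
    left = solve 3 (λ k x y → k :* x :+ :0 :* y := k :* x) refl
    right : ∀ k x y → 0# * x + k * y ≡ k * y
    right = solve 3 (λ k x y → :0 :* x :+ k :* y := k :* y) refl

  ⊙-scalar : ∀ k m → m ⊙ scalar k ≡ scale k m
  ⊙-scalar k (a , b , c , d) = mat-≡ (left k a b) (right k a b) (left k c d) (right k c d)
    where
    left : ∀ k x y → x * k + y * 0# ≡ k * x
    left = solve 3 (λ k x y → x :* k :+ y :* :0 := k :* x) refl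
    right : ∀ k x y → x * 0# + y * k ≡ k * y
    right = solve 3 (λ k x y → x :* :0 :+ y :* k := k :* y) refl

  scale-⊙ : ∀ k m n → scale k m ⊙ n ≡ scale k (m ⊙ n)
  scale-⊙ k (a , b , c , d) (e , f , g , h) = mat-≡ (entry a b e g) (entry a b f h) (entry c d e g) (entry c d f h)
    where
    entry : ∀ x y z w → k * x * z + k * y * w ≡ k * (x * z + y * w)
    entry = solve 5 (λ k x y z w → k :* x :* z :+ k :* y :* w := k :* (x :* z :+ y :* w)) refl k

  scale-scale : ∀ k l m → scale k (scale l m) ≡ scale (k * l) m
  scale-scale k l (a , b , c , d) = mat-≡ (entry a) (entry b) (entry c) (entry d)
    where
    entry : ∀ x → k * (l * x) ≡ k * l * x
    entry x = sym (*-assoc k l x)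

  scale-1 : ∀ m → scale 1# m ≡ m
  scale-1 (a , b , c , d) = mat-≡ (*-identityˡ a) (*-identityˡ b) (*-identityˡ c) (*-identityˡ d)

  ⊙-identityʳ : ∀ m → m ⊙ scalar 1# ≡ m
  ⊙-identityʳ m = trans (⊙-scalar 1# m) (scale-1 m)

  adj-⊙ : ∀ m → adj m ⊙ m ≡ scalar (det m)
  adj-⊙ (a , b , c , d) = mat-≡ (solve 4 (λ a b c d → d :* a :+ (:- b) :* c := a :* d :- b :* c) refl a b c d)
                                (solve 4 (λ a b c d → d :* b :+ (:- b) :* d := :0) refl a b c d)
                                (solve 4 (λ a b c d → (:- c) :* a :+ a :* c := :0) refl a b c d)
                                (solve 4 (λ a b c d → (:- c) :* b :+ a :* d := a :* d :- b :* c) refl a b c d)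

  ⊙-adj : ∀ m → m ⊙ adj m ≡ scalar (det m)
  ⊙-adj (a , b , c , d) = mat-≡ (solve 4 (λ a b c d → a :* d :+ b :* (:- c) := a :* d :- b :* c) refl a b c d)
                                (solve 4 (λ a b c d → a :* (:- b) :+ b :* a := :0) refl a b c d)
                                (solve 4 (λ a b c d → c :* d :+ d :* (:- c) := :0) refl a b c d)
                                (solve 4 (λ a b c d → c :* (:- b) :+ d :* a := a :* d :- b :* c) refl a b c d)

  adj-⊙-cancel : ∀ m n → adj m ⊙ (m ⊙ n) ≡ scale (det m) n
  adj-⊙-cancel m n = trans (sym (⊙-assoc (adj m) m n)) (trans (cong (_⊙ n) (adj-⊙ m)) (scalar-⊙ (det m) n))

  ⊙-adj-cancel : ∀ m n → m ⊙ (adj m ⊙ n) ≡ scale (det m) n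
  ⊙-adj-cancel m n = trans (sym (⊙-assoc m (adj m) n)) (trans (cong (_⊙ n) (⊙-adj m)) (scalar-⊙ (det m) n))

  det-⊙ : ∀ m n → det (m ⊙ n) ≡ det m * det n
  det-⊙ (a , b , c , d) (e , f , g , h) = solve 8 (λ a b c d e f g h →
    (a :* e :+ b :* g) :* (c :* f :+ d :* h) :- (a :* f :+ b :* h) :* (c :* e :+ d :* g)
    := (a :* d :- b :* c) :* (e :* h :- f :* g)) refl a b c d e f g h

  det-adj : ∀ m → det (adj m) ≡ det m
  det-adj (a , b , c , d) = solve 4 (λ a b c d → d :* a :- (:- b) :* (:- c) := a :* d :- b :* c) refl a b c d

  det-scale : ∀ k m → det (scale k m) ≡ k * k * det m
  det-scale k (a , b , c , d) = solve 5 (λ k a b c d → k :* a :* (k :* d) :- k :* b :* (k :* c)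
                                                     := k :* k :* (a :* d :- b :* c)) refl k a b c d

  apply₁-⊙ : ∀ m n u v → apply₁ (m ⊙ n) u v ≡ apply₁ m (apply₁ n u v) (apply₂ n u v)
  apply₁-⊙ (a , b , c , d) (e , f , g , h) u v = solve 8 (λ a b e f g h u v →
    (a :* e :+ b :* g) :* u :+ (a :* f :+ b :* h) :* v := a :* (e :* u :+ f :* v) :+ b :* (g :* u :+ h :* v)) refl a b e f g h u v

  apply₂-⊙ : ∀ m n u v → apply₂ (m ⊙ n) u v ≡ apply₂ m (apply₁ n u v) (apply₂ n u v)
  apply₂-⊙ (a , b , c , d) (e , f , g , h) u v = solve 8 (λ c d e f g h u v →
    (c :* e :+ d :* g) :* u :+ (c :* f :+ d :* h) :* v := c :* (e :* u :+ f :* v) :+ d :* (g :* u :+ h :* v)) refl c d e f g h u v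

  NonZeroPair-apply : ∀ m u v → det m ≢ 0# → NonZeroPair u v → NonZeroPair (apply₁ m u v) (apply₂ m u v)
  NonZeroPair-apply (a , b , c , d) u v det≢0 nz x≡0 y≡0 = nz (x*y≡0⇒y≡0 _ u det≢0 (begin
      (a * d - b * c) * u                      ≡⟨ solve 6 (λ a b c d u v → (a :* d :- b :* c) :* u
                                                    := d :* (a :* u :+ b :* v) :- b :* (c :* u :+ d :* v)) refl a b c d u v ⟩
      d * (a * u + b * v) - b * (c * u + d * v) ≡⟨ cong₂ (λ x y → d * x - b * y) x≡0 y≡0 ⟩
      d * 0# - b * 0#                          ≡⟨ solve 2 (λ b d → d :* :0 :- b :* :0 := :0) refl b d ⟩
      0#                                       ∎))
    (x*y≡0⇒y≡0 _ v det≢0 (begin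
      (a * d - b * c) * v                      ≡⟨ solve 6 (λ a b c d u v → (a :* d :- b :* c) :* v
                                                    := a :* (c :* u :+ d :* v) :- c :* (a :* u :+ b :* v)) refl a b c d u v ⟩
      a * (c * u + d * v) - c * (a * u + b * v) ≡⟨ cong₂ (λ x y → a * y - c * x) x≡0 y≡0 ⟩
      a * 0# - c * 0#                          ≡⟨ solve 2 (λ a c → a :* :0 :- c :* :0 := :0) refl a c ⟩
      0#                                       ∎))
    where open ≡-Reasoning

  act-hom : ∀ m p → act m p ≡ point (apply₁ m (hom₁ p) (hom₂ p)) (apply₂ m (hom₁ p) (hom₂ p))
  act-hom m p = trans (cong (act m) (sym (point-hom p))) (act-point m _ _ (NonZeroPair-hom p))

  act-⊙ : ∀ m n p → det n ≢ 0# → act (m ⊙ n) p ≡ act m (act n p)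
  act-⊙ m n p det≢0 = begin
    act (m ⊙ n) p                                       ≡⟨ act-hom (m ⊙ n) p ⟩
    point (apply₁ (m ⊙ n) u v) (apply₂ (m ⊙ n) u v)     ≡⟨ cong₂ point (apply₁-⊙ m n u v) (apply₂-⊙ m n u v) ⟩
    point (apply₁ m u′ v′) (apply₂ m u′ v′)             ≡⟨ sym (act-point m u′ v′ (NonZeroPair-apply n u v det≢0 (NonZeroPair-hom p))) ⟩
    act m (point u′ v′)                                 ≡⟨ cong (act m) (sym (act-hom n p)) ⟩
    act m (act n p)                                     ∎
    where
    open ≡-Reasoning
    u = hom₁ p
    v = hom₂ p
    u′ = apply₁ n u v
    v′ = apply₂ n u v

  act-scale : ∀ k m p → k ≢ 0# → act (scale k m) p ≡ act m p
  act-scale k m@(a , b , c , d) p k≢0 = begin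
    act (scale k m) p                                   ≡⟨ act-hom (scale k m) p ⟩
    point (k * a * u + k * b * v) (k * c * u + k * d * v) ≡⟨ cong₂ point (factor a b) (factor c d) ⟩
    point (k * (a * u + b * v)) (k * (c * u + d * v))   ≡⟨ point-scale k _ _ k≢0 ⟩
    point (a * u + b * v) (c * u + d * v)               ≡⟨ sym (act-hom m p) ⟩
    act m p                                             ∎
    where
    open ≡-Reasoning
    u = hom₁ p
    v = hom₂ p
    factor : ∀ x y → k * x * u + k * y * v ≡ k * (x * u + y * v)
    factor x y = solve 5 (λ k x y u v → k :* x :* u :+ k :* y :* v := k :* (x :* u :+ y :* v)) refl k x y u v

  act-scalar : ∀ k p → k ≢ 0# → act (scalar k) p ≡ p
  act-scalar k p k≢0 = begin
    act (scalar k) p                                    ≡⟨ act-hom (scalar k) p ⟩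
    point (k * u + 0# * v) (0# * u + k * v)             ≡⟨ cong₂ point (solve 3 (λ k u v → k :* u :+ :0 :* v := k :* u) refl k u v)
                                                                       (solve 3 (λ k u v → :0 :* u :+ k :* v := k :* v) refl k u v) ⟩
    point (k * u) (k * v)                               ≡⟨ point-scale k u v k≢0 ⟩
    point u v                                           ≡⟨ point-hom p ⟩
    p                                                   ∎
    where
    open ≡-Reasoning
    u = hom₁ p
    v = hom₂ p

  act-adj-act : ∀ m p → det m ≢ 0# → act (adj m) (act m p) ≡ p
  act-adj-act m p det≢0 = begin
    act (adj m) (act m p)    ≡⟨ sym (act-⊙ (adj m) m p det≢0) ⟩
    act (adj m ⊙ m) p        ≡⟨ cong (λ n → act n p) (adj-⊙ m) ⟩
    act (scalar (det m)) p   ≡⟨ act-scalar (det m) p det≢0 ⟩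
    p                        ∎
    where open ≡-Reasoning

  act-act-adj : ∀ m p → det m ≢ 0# → act m (act (adj m) p) ≡ p
  act-act-adj m p det≢0 = begin
    act m (act (adj m) p)    ≡⟨ sym (act-⊙ m (adj m) p (λ e → det≢0 (trans (sym (det-adj m)) e))) ⟩
    act (m ⊙ adj m) p        ≡⟨ cong (λ n → act n p) (⊙-adj m) ⟩
    act (scalar (det m)) p   ≡⟨ act-scalar (det m) p det≢0 ⟩
    p                        ∎
    where open ≡-Reasoning

  act-injective : ∀ m {p p′} → det m ≢ 0# → act m p ≡ act m p′ → p ≡ p′
  act-injective m {p} {p′} det≢0 eq =
    trans (sym (act-adj-act m p det≢0)) (trans (cong (act (adj m)) eq) (act-adj-act m p′ det≢0))

  pt₀ pt₁ pt∞ : Point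
  pt₀ = point 0# 1#
  pt₁ = point 1# 1#
  pt∞ = point 1# 0#

  fixes-pt₀pt₁pt∞⇒scalar : ∀ a b c d → act (a , b , c , d) pt₀ ≡ pt₀ → act (a , b , c , d) pt₁ ≡ pt₁ → act (a , b , c , d) pt∞ ≡ pt∞ →
    (a , b , c , d) ≡ scalar a
  fixes-pt₀pt₁pt∞⇒scalar a b c d fix₀ fix₁ fix∞ = mat-≡ refl b≡0 c≡0 (sym a≡d)
    where
    fixed : ∀ u v → NonZeroPair u v → act (a , b , c , d) (point u v) ≡ point u v →
      (a * u + b * v) * v ≡ u * (c * u + d * v)
    fixed u v nz eq = point-injective _ _ _ _ (trans (sym (act-point (a , b , c , d) u v nz)) eq)
    b≡0 : b ≡ 0#
    b≡0 = trans (solve 2 (λ a b → b := (a :* :0 :+ b :* :1) :* :1) refl a b)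
           (trans (fixed 0# 1# (λ _ → 1≢0) fix₀) (solve 2 (λ c d → :0 :* (c :* :0 :+ d :* :1) := :0) refl c d))
    c≡0 : c ≡ 0#
    c≡0 = trans (solve 2 (λ c d → c := :1 :* (c :* :1 :+ d :* :0)) refl c d)
           (trans (sym (fixed 1# 0# (λ 1≡0 → ⊥-elim (1≢0 1≡0)) fix∞)) (solve 2 (λ a b → (a :* :1 :+ b :* :0) :* :0 := :0) refl a b))
    a≡d : a ≡ d
    a≡d = begin
      a                              ≡⟨ solve 2 (λ a b → a := (a :* :1 :+ b :* :1) :* :1 :- b) refl a b ⟩
      (a * 1# + b * 1#) * 1# - b     ≡⟨ cong (_- b) (fixed 1# 1# (λ _ → 1≢0) fix₁) ⟩
      1# * (c * 1# + d * 1#) - b     ≡⟨ cong₂ (λ x y → 1# * (y * 1# + d * 1#) - x) b≡0 c≡0 ⟩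
      1# * (0# * 1# + d * 1#) - 0#   ≡⟨ solve 1 (λ d → :1 :* (:0 :* :1 :+ d :* :1) :- :0 := d) refl d ⟩
      d                              ∎
      where open ≡-Reasoning

  scale-cancel : ∀ k m n → k ≢ 0# → scale k m ≡ n → m ≡ scale (inv k) n
  scale-cancel k m n k≢0 km≡n = begin
    m                          ≡⟨ sym (scale-1 m) ⟩
    scale 1# m                 ≡⟨ cong (λ x → scale x m) (sym (*-inverseˡ k k≢0)) ⟩
    scale (inv k * k) m        ≡⟨ sym (scale-scale (inv k) k m) ⟩
    scale (inv k) (scale k m)  ≡⟨ cong (scale (inv k)) km≡n ⟩
    scale (inv k) n            ∎
    where open ≡-Reasoning

module ThreeTransitivity {q : ℕ} (F : FiniteField q) where

  open FieldArithmetic F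
  open ProjectiveLine F
  open Matrices F

  Distinct₃ : Point → Point → Point → Set
  Distinct₃ p₁ p₂ p₃ = p₁ ≢ p₂ × p₂ ≢ p₃ × p₁ ≢ p₃

  -- The columns are the coordinates of p₃ and p₁, weighted so that their sum is
  -- δ p₃ p₁ times the coordinates of p₂ (a three-term Plücker relation).
  frame : Point → Point → Point → Mat
  frame p₁ p₂ p₃ = (δ p₂ p₁ * hom₁ p₃ , δ p₃ p₂ * hom₁ p₁ , δ p₂ p₁ * hom₂ p₃ , δ p₃ p₂ * hom₂ p₁)

  det-frame : ∀ p₁ p₂ p₃ → det (frame p₁ p₂ p₃) ≡ δ p₂ p₁ * δ p₃ p₂ * δ p₃ p₁
  det-frame p₁ p₂ p₃ = solve 6 (λ u₁ v₁ u₂ v₂ u₃ v₃ →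
       (u₂ :* v₁ :- u₁ :* v₂) :* u₃ :* ((u₃ :* v₂ :- u₂ :* v₃) :* v₁) :- (u₃ :* v₂ :- u₂ :* v₃) :* u₁ :* ((u₂ :* v₁ :- u₁ :* v₂) :* v₃)
    := (u₂ :* v₁ :- u₁ :* v₂) :* (u₃ :* v₂ :- u₂ :* v₃) :* (u₃ :* v₁ :- u₁ :* v₃))
    refl (hom₁ p₁) (hom₂ p₁) (hom₁ p₂) (hom₂ p₂) (hom₁ p₃) (hom₂ p₃)

  det-frame-≢0 : ∀ {p₁ p₂ p₃} → Distinct₃ p₁ p₂ p₃ → det (frame p₁ p₂ p₃) ≢ 0#
  det-frame-≢0 {p₁} {p₂} {p₃} (p₁≢p₂ , p₂≢p₃ , p₁≢p₃) det≡0 =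
    *-≢0 _ _ (*-≢0 _ _ (δ-≢0 p₂ p₁ (p₁≢p₂ ∘ sym)) (δ-≢0 p₃ p₂ (p₂≢p₃ ∘ sym))) (δ-≢0 p₃ p₁ (p₁≢p₃ ∘ sym))
      (trans (sym (det-frame p₁ p₂ p₃)) det≡0)

  frame-pt₀ : ∀ {p₁ p₂ p₃} → Distinct₃ p₁ p₂ p₃ → act (frame p₁ p₂ p₃) pt₀ ≡ p₁
  frame-pt₀ {p₁} {p₂} {p₃} (_ , p₂≢p₃ , _) = begin
    act (frame p₁ p₂ p₃) pt₀                                          ≡⟨ act-point (frame p₁ p₂ p₃) 0# 1# (λ _ → 1≢0) ⟩
    point (δ₂₁ * hom₁ p₃ * 0# + δ₃₂ * hom₁ p₁ * 1#) (δ₂₁ * hom₂ p₃ * 0# + δ₃₂ * hom₂ p₁ * 1#)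
                                                                     ≡⟨ cong₂ point (second-column _ _) (second-column _ _) ⟩
    point (δ₃₂ * hom₁ p₁) (δ₃₂ * hom₂ p₁)                            ≡⟨ point-scale δ₃₂ _ _ (δ-≢0 p₃ p₂ (p₂≢p₃ ∘ sym)) ⟩
    point (hom₁ p₁) (hom₂ p₁)                                        ≡⟨ point-hom p₁ ⟩
    p₁                                                               ∎
    where
    open ≡-Reasoning
    δ₂₁ = δ p₂ p₁
    δ₃₂ = δ p₃ p₂
    second-column : ∀ x y → x * 0# + y * 1# ≡ y
    second-column = solve 2 (λ x y → x :* :0 :+ y :* :1 := y) refl

  frame-pt∞ : ∀ {p₁ p₂ p₃} → Distinct₃ p₁ p₂ p₃ → act (frame p₁ p₂ p₃) pt∞ ≡ p₃
  frame-pt∞ {p₁} {p₂} {p₃} (p₁≢p₂ , _ , _) = begin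
    act (frame p₁ p₂ p₃) pt∞                                          ≡⟨ act-point (frame p₁ p₂ p₃) 1# 0# (λ 1≡0 → ⊥-elim (1≢0 1≡0)) ⟩
    point (δ₂₁ * hom₁ p₃ * 1# + δ₃₂ * hom₁ p₁ * 0#) (δ₂₁ * hom₂ p₃ * 1# + δ₃₂ * hom₂ p₁ * 0#)
                                                                     ≡⟨ cong₂ point (first-column _ _) (first-column _ _) ⟩
    point (δ₂₁ * hom₁ p₃) (δ₂₁ * hom₂ p₃)                            ≡⟨ point-scale δ₂₁ _ _ (δ-≢0 p₂ p₁ (p₁≢p₂ ∘ sym)) ⟩
    point (hom₁ p₃) (hom₂ p₃)                                        ≡⟨ point-hom p₃ ⟩
    p₃                                                               ∎
    where
    open ≡-Reasoning
    δ₂₁ = δ p₂ p₁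
    δ₃₂ = δ p₃ p₂
    first-column : ∀ x y → x * 1# + y * 0# ≡ x
    first-column = solve 2 (λ x y → x :* :1 :+ y :* :0 := x) refl

  frame-pt₁ : ∀ {p₁ p₂ p₃} → Distinct₃ p₁ p₂ p₃ → act (frame p₁ p₂ p₃) pt₁ ≡ p₂
  frame-pt₁ {p₁} {p₂} {p₃} (_ , _ , p₁≢p₃) = begin
    act (frame p₁ p₂ p₃) pt₁                                         ≡⟨ act-point (frame p₁ p₂ p₃) 1# 1# (λ _ → 1≢0) ⟩
    point (δ₂₁ * u₃ * 1# + δ₃₂ * u₁ * 1#) (δ₂₁ * v₃ * 1# + δ₃₂ * v₁ * 1#)
                                                                     ≡⟨ cong₂ point (plücker₁ u₁ v₁ u₂ v₂ u₃ v₃) (plücker₂ u₁ v₁ u₂ v₂ u₃ v₃) ⟩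
    point (δ p₃ p₁ * u₂) (δ p₃ p₁ * v₂)                              ≡⟨ point-scale (δ p₃ p₁) _ _ (δ-≢0 p₃ p₁ (p₁≢p₃ ∘ sym)) ⟩
    point u₂ v₂                                                      ≡⟨ point-hom p₂ ⟩
    p₂                                                               ∎
    where
    open ≡-Reasoning
    δ₂₁ = δ p₂ p₁
    δ₃₂ = δ p₃ p₂
    u₁ = hom₁ p₁
    v₁ = hom₂ p₁
    u₂ = hom₁ p₂
    v₂ = hom₂ p₂
    u₃ = hom₁ p₃
    v₃ = hom₂ p₃
    plücker₁ : ∀ u₁ v₁ u₂ v₂ u₃ v₃ → (u₂ * v₁ - u₁ * v₂) * u₃ * 1# + (u₃ * v₂ - u₂ * v₃) * u₁ * 1# ≡ (u₃ * v₁ - u₁ * v₃) * u₂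
    plücker₁ = solve 6 (λ u₁ v₁ u₂ v₂ u₃ v₃ →
      (u₂ :* v₁ :- u₁ :* v₂) :* u₃ :* :1 :+ (u₃ :* v₂ :- u₂ :* v₃) :* u₁ :* :1 := (u₃ :* v₁ :- u₁ :* v₃) :* u₂) refl
    plücker₂ : ∀ u₁ v₁ u₂ v₂ u₃ v₃ → (u₂ * v₁ - u₁ * v₂) * v₃ * 1# + (u₃ * v₂ - u₂ * v₃) * v₁ * 1# ≡ (u₃ * v₁ - u₁ * v₃) * v₂
    plücker₂ = solve 6 (λ u₁ v₁ u₂ v₂ u₃ v₃ →
      (u₂ :* v₁ :- u₁ :* v₂) :* v₃ :* :1 :+ (u₃ :* v₂ :- u₂ :* v₃) :* v₁ :* :1 := (u₃ :* v₁ :- u₁ :* v₃) :* v₂) refl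

  Sends : Mat → Point → Point → Point → Point → Point → Point → Set
  Sends m b₁ b₂ b₃ t₁ t₂ t₃ = act m b₁ ≡ t₁ × act m b₂ ≡ t₂ × act m b₃ ≡ t₃

  module Transport {b₁ b₂ b₃ t₁ t₂ t₃ : Point} (db : Distinct₃ b₁ b₂ b₃) (dt : Distinct₃ t₁ t₂ t₃) where

    Cb Ct transport : Mat
    Cb = frame b₁ b₂ b₃
    Ct = frame t₁ t₂ t₃
    transport = Ct ⊙ adj Cb

    det-transport : det transport ≡ det Ct * det Cb
    det-transport = trans (det-⊙ Ct (adj Cb)) (cong (det Ct *_) (det-adj Cb))

    det-transport-≢0 : det transport ≢ 0#
    det-transport-≢0 det≡0 = *-≢0 _ _ (det-frame-≢0 dt) (det-frame-≢0 db) (trans (sym det-transport) det≡0)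

    scale-transport-sends : ∀ k → k ≢ 0# → Sends (scale k transport) b₁ b₂ b₃ t₁ t₂ t₃
    scale-transport-sends k k≢0 = via pt₀ (frame-pt₀ db) (frame-pt₀ dt) , via pt₁ (frame-pt₁ db) (frame-pt₁ dt) , via pt∞ (frame-pt∞ db) (frame-pt∞ dt)
      where
      det-adj-Cb-≢0 : det (adj Cb) ≢ 0#
      det-adj-Cb-≢0 det≡0 = det-frame-≢0 db (trans (sym (det-adj Cb)) det≡0)
      via : ∀ s {b t} → act Cb s ≡ b → act Ct s ≡ t → act (scale k transport) b ≡ t
      via s {b} {t} Cb-s≡b Ct-s≡t = begin
        act (scale k transport) b    ≡⟨ act-scale k transport b k≢0 ⟩
        act (Ct ⊙ adj Cb) b          ≡⟨ act-⊙ Ct (adj Cb) b det-adj-Cb-≢0 ⟩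
        act Ct (act (adj Cb) b)      ≡⟨ cong (λ p → act Ct (act (adj Cb) p)) (sym Cb-s≡b) ⟩
        act Ct (act (adj Cb) (act Cb s)) ≡⟨ cong (act Ct) (act-adj-act Cb s (det-frame-≢0 db)) ⟩
        act Ct s                     ≡⟨ Ct-s≡t ⟩
        t                            ∎
        where open ≡-Reasoning

    -- adj Ct ⊙ m ⊙ Cb fixes pt₀, pt₁ and pt∞, hence is scalar.
    sends⇒scale-transport : ∀ m → det m ≢ 0# → Sends m b₁ b₂ b₃ t₁ t₂ t₃ → ∃ λ k → k ≢ 0# × m ≡ scale k transport
    sends⇒scale-transport m det≢0 (m-b₁ , m-b₂ , m-b₃) = inv D * w , k≢0 , m≡
      where
      W = adj Ct ⊙ (m ⊙ Cb)
      w = proj₁ W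
      D = det Ct * det Cb
      D≢0 : D ≢ 0#
      D≢0 = *-≢0 _ _ (det-frame-≢0 dt) (det-frame-≢0 db)
      det-mCb-≢0 : det (m ⊙ Cb) ≢ 0#
      det-mCb-≢0 det≡0 = *-≢0 _ _ det≢0 (det-frame-≢0 db) (trans (sym (det-⊙ m Cb)) det≡0)
      W-fixes : ∀ s {b t} → act Cb s ≡ b → act Ct s ≡ t → act m b ≡ t → act W s ≡ s
      W-fixes s {b} {t} Cb-s≡b Ct-s≡t m-b≡t = begin
        act W s                              ≡⟨ act-⊙ (adj Ct) (m ⊙ Cb) s det-mCb-≢0 ⟩
        act (adj Ct) (act (m ⊙ Cb) s)        ≡⟨ cong (act (adj Ct)) (act-⊙ m Cb s (det-frame-≢0 db)) ⟩
        act (adj Ct) (act m (act Cb s))      ≡⟨ cong (λ p → act (adj Ct) (act m p)) Cb-s≡b ⟩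
        act (adj Ct) (act m b)               ≡⟨ cong (act (adj Ct)) (trans m-b≡t (sym Ct-s≡t)) ⟩
        act (adj Ct) (act Ct s)              ≡⟨ act-adj-act Ct s (det-frame-≢0 dt) ⟩
        s                                    ∎
        where open ≡-Reasoning
      W≡scalar : W ≡ scalar w
      W≡scalar = fixes-pt₀pt₁pt∞⇒scalar _ _ _ _ (W-fixes pt₀ (frame-pt₀ db) (frame-pt₀ dt) m-b₁)
                   (W-fixes pt₁ (frame-pt₁ db) (frame-pt₁ dt) m-b₂) (W-fixes pt∞ (frame-pt∞ db) (frame-pt∞ dt) m-b₃)
      mCb≡ : scale (det Ct) (m ⊙ Cb) ≡ scale w Ct
      mCb≡ = begin
        scale (det Ct) (m ⊙ Cb)   ≡⟨ sym (⊙-adj-cancel Ct (m ⊙ Cb)) ⟩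
        Ct ⊙ W                    ≡⟨ cong (Ct ⊙_) W≡scalar ⟩
        Ct ⊙ scalar w             ≡⟨ ⊙-scalar w Ct ⟩
        scale w Ct                ∎
        where open ≡-Reasoning
      Dm≡ : scale D m ≡ scale w transport
      Dm≡ = begin
        scale D m                                ≡⟨ sym (scale-scale (det Ct) (det Cb) m) ⟩
        scale (det Ct) (scale (det Cb) m)        ≡⟨ cong (scale (det Ct)) (sym (⊙-scalar (det Cb) m)) ⟩
        scale (det Ct) (m ⊙ scalar (det Cb))     ≡⟨ cong (λ n → scale (det Ct) (m ⊙ n)) (sym (⊙-adj Cb)) ⟩
        scale (det Ct) (m ⊙ (Cb ⊙ adj Cb))       ≡⟨ cong (scale (det Ct)) (sym (⊙-assoc m Cb (adj Cb))) ⟩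
        scale (det Ct) (m ⊙ Cb ⊙ adj Cb)         ≡⟨ sym (scale-⊙ (det Ct) (m ⊙ Cb) (adj Cb)) ⟩
        scale (det Ct) (m ⊙ Cb) ⊙ adj Cb         ≡⟨ cong (_⊙ adj Cb) mCb≡ ⟩
        scale w Ct ⊙ adj Cb                      ≡⟨ scale-⊙ w Ct (adj Cb) ⟩
        scale w transport                        ∎
        where open ≡-Reasoning
      m≡ : m ≡ scale (inv D * w) transport
      m≡ = trans (scale-cancel D m _ D≢0 Dm≡) (scale-scale (inv D) w transport)
      k≢0 : inv D * w ≢ 0#
      k≢0 k≡0 = det≢0 (begin
        det m                                           ≡⟨ cong det m≡ ⟩
        det (scale (inv D * w) transport)               ≡⟨ det-scale (inv D * w) transport ⟩
        (inv D * w) * (inv D * w) * det transport       ≡⟨ cong (λ k → k * k * det transport) k≡0 ⟩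
        0# * 0# * det transport                         ≡⟨ solve 1 (λ x → :0 :* :0 :* x := :0) refl (det transport) ⟩
        0#                                              ∎)
        where open ≡-Reasoning

module QuadraticResidues {q : ℕ} (F : FiniteField q) (j : ℕ) (q≡1+4j : q ≡ suc (j Nat.* 4)) where

  open FieldArithmetic F
  open Counting
  open IntegerIdentities

  length-elems : length elems ≡ q
  length-elems = ListP.length-tabulate (λ x → x)

  2∣j*4 : 2 ∣ j Nat.* 4
  2∣j*4 = divides (j Nat.* 2) (sym (ℕP.*-assoc j 2 2))

  -- Otherwise x ↦ x + 1 would be a fixed-point-free involution on a set of odd size q.
  1+1≢0 : 1# + 1# ≢ 0#
  1+1≢0 2≡0 = 2∣n⇒2∤1+n 2∣j*4 (subst (2 ∣_) (trans length-elems q≡1+4j)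
    (involution-even (_+ 1#) +1+1 elems (UniqueP.allFin⁺ q) (λ x _ → ∈-allFin (x + 1#)) (λ x _ → +1≢id x)))
    where
    +1+1 : ∀ x → x + 1# + 1# ≡ x
    +1+1 x = trans (solve 2 (λ x o → x :+ o :+ o := x :+ (o :+ o)) refl x 1#)
               (trans (cong (x +_) 2≡0) (solve 1 (λ x → x :+ :0 := x) refl x))
    +1≢id : ∀ x → x + 1# ≢ x
    +1≢id x x+1≡x = 1≢0 (trans (solve 2 (λ x o → o := (x :+ o) :- x) refl x 1#)
                     (trans (cong (_- x) x+1≡x) (solve 1 (λ x → x :- x := :0) refl x)))

  x≢-x : ∀ x → x ≢ 0# → x ≢ - x
  x≢-x x x≢0 x≡-x = x≢0 (x*y≡0⇒y≡0 (1# + 1#) x 1+1≢0 (begin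
    (1# + 1#) * x   ≡⟨ solve 1 (λ x → (:1 :+ :1) :* x := x :+ x) refl x ⟩
    x + x           ≡⟨ cong (x +_) x≡-x ⟩
    x + - x         ≡⟨ solve 1 (λ x → x :+ (:- x) := :0) refl x ⟩
    0#              ∎))
    where open ≡-Reasoning

  x*x≡y*y⇒x≡±y : ∀ x y → x * x ≡ y * y → x ≡ y ⊎ x ≡ - y
  x*x≡y*y⇒x≡±y x y x²≡y² with x - y ≟ 0#
  ... | yes x-y≡0 = inj₁ (x-y≡0⇒x≡y x y x-y≡0)
  ... | no x-y≢0  = inj₂ (x-y≡0⇒x≡y x (- y) (trans (solve 2 (λ x y → x :- (:- y) := x :+ y) refl x y)
        (x*y≡0⇒y≡0 (x - y) (x + y) x-y≢0 (begin
          (x - y) * (x + y)   ≡⟨ solve 2 (λ x y → (x :- y) :* (x :+ y) := x :* x :- y :* y) refl x y ⟩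
          x * x - y * y       ≡⟨ cong (_- y * y) x²≡y² ⟩
          y * y - y * y       ≡⟨ solve 1 (λ y → y :* y :- y :* y := :0) refl y ⟩
          0#                  ∎))))
    where open ≡-Reasoning

  IsSquare : Fin q → Set
  IsSquare a = ∃ λ y → y * y ≡ a

  square? : Decidable IsSquare
  square? a = map′ satisfied (λ (y , y²≡a) → lose (∈-allFin y) y²≡a) (any? (λ y → y * y ≟ a) elems)

  χ-square : ∀ a → a ≢ 0# → IsSquare a → χ a ≡ 1ℤ
  χ-square a a≢0 (y , y²≡a) with a ≟ 0#
  ... | yes a≡0 = ⊥-elim (a≢0 a≡0)
  ... | no _ with any? (λ y → y * y ≟ a) elems
  ...   | yes _         = refl
  ...   | no no-witness = ⊥-elim (no-witness (lose (∈-allFin y) y²≡a))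

  χ-nonsquare : ∀ a → a ≢ 0# → ¬ IsSquare a → χ a ≡ -1ℤ
  χ-nonsquare a a≢0 ¬square with a ≟ 0#
  ... | yes a≡0 = ⊥-elim (a≢0 a≡0)
  ... | no _ with any? (λ y → y * y ≟ a) elems
  ...   | yes witness = ⊥-elim (¬square (satisfied witness))
  ...   | no _        = refl

  ∑χ : ∀ xs → (∀ x → x ∈ xs → x ≢ 0#) →
    foldr ℤ._+_ 0ℤ (map χ xs) ≡ ℤ.+ count square? xs ℤ.- ℤ.+ count (¬? ∘ square?) xs
  ∑χ []       _      = refl
  ∑χ (x ∷ xs) all≢0 = begin
    χ x ℤ.+ foldr ℤ._+_ 0ℤ (map χ xs)                                ≡⟨ cong (λ w → χ x ℤ.+ w) (∑χ xs (λ y y∈ → all≢0 y (there y∈))) ⟩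
    χ x ℤ.+ (ℤ.+ P ℤ.- ℤ.+ N)                                         ≡⟨ step (square? x) ⟩
    ℤ.+ (indicator (square? x) Nat.+ P) ℤ.- ℤ.+ (indicator (¬? (square? x)) Nat.+ N)
                                                                     ≡⟨ sym (cong₂ (λ u v → ℤ.+ u ℤ.- ℤ.+ v) (count-∷ square? x xs) (count-∷ (¬? ∘ square?) x xs)) ⟩
    ℤ.+ count square? (x ∷ xs) ℤ.- ℤ.+ count (¬? ∘ square?) (x ∷ xs) ∎
    where
    open ≡-Reasoning
    P = count square? xs
    N = count (¬? ∘ square?) xs
    step : (x-sq? : Dec (IsSquare x)) →
      χ x ℤ.+ (ℤ.+ P ℤ.- ℤ.+ N) ≡ ℤ.+ (indicator x-sq? Nat.+ P) ℤ.- ℤ.+ (indicator (¬? x-sq?) Nat.+ N)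
    step (yes x-sq)    = trans (cong (ℤ._+ (ℤ.+ P ℤ.- ℤ.+ N)) (χ-square x (all≢0 x (here refl)) x-sq))
                           (1+[m-n]≡[1+m]-n (ℤ.+ P) (ℤ.+ N))
    step (no x-nonsq)  = trans (cong (ℤ._+ (ℤ.+ P ℤ.- ℤ.+ N)) (χ-nonsquare x (all≢0 x (here refl)) x-nonsq))
                           (-1+[m-n]≡m-[1+n] (ℤ.+ P) (ℤ.+ N))

  square-* : ∀ a b → IsSquare a → IsSquare b → IsSquare (a * b)
  square-* a b (r , refl) (s , refl) = r * s , solve 2 (λ r s → (r :* s) :* (r :* s) := (r :* r) :* (s :* s)) refl r s

  square-cancelˡ : ∀ a b → a ≢ 0# → IsSquare a → IsSquare (a * b) → IsSquare b
  square-cancelˡ a b a≢0 (s , refl) (r , r²≡s²b) = r * inv s , (begin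
    r * inv s * (r * inv s)          ≡⟨ solve 2 (λ r s⁻¹ → r :* s⁻¹ :* (r :* s⁻¹) := (r :* r) :* (s⁻¹ :* s⁻¹)) refl r (inv s) ⟩
    (r * r) * (inv s * inv s)        ≡⟨ cong (_* (inv s * inv s)) r²≡s²b ⟩
    (s * s * b) * (inv s * inv s)    ≡⟨ solve 3 (λ s b s⁻¹ → (s :* s :* b) :* (s⁻¹ :* s⁻¹) := b :* (s :* s⁻¹) :* (s :* s⁻¹)) refl s b (inv s) ⟩
    b * (s * inv s) * (s * inv s)    ≡⟨ cong (λ w → b * w * w) (*-inverseʳ s s≢0) ⟩
    b * 1# * 1#                      ≡⟨ solve 1 (λ b → b :* :1 :* :1 := b) refl b ⟩
    b                                ∎)
    where
    open ≡-Reasoning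
    s≢0 : s ≢ 0#
    s≢0 s≡0 = a≢0 (trans (cong (λ w → w * w) s≡0) (zeroʳ 0#))

  units : List (Fin q)
  units = filter (λ x → ¬? (x ≟ 0#)) elems

  units-unique : Unique units
  units-unique = UniqueP.filter⁺ _ (UniqueP.allFin⁺ q)

  ∈-units : ∀ {x} → x ≢ 0# → x ∈ units
  ∈-units {x} x≢0 = ∈-filter⁺ (λ x → ¬? (x ≟ 0#)) (∈-allFin x) x≢0

  units-≢0 : ∀ {x} → x ∈ units → x ≢ 0#
  units-≢0 x∈ = proj₂ (∈-filter⁻ (λ x → ¬? (x ≟ 0#)) {xs = elems} x∈)

  length-units : length units ≡ j Nat.* 4
  length-units = ℕP.suc-injective (begin
    suc (length units)                                 ≡⟨ cong (Nat._+ length units) (sym (count-≟ _≟_ elems (UniqueP.allFin⁺ q) 0# (∈-allFin 0#))) ⟩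
    count (_≟ 0#) elems Nat.+ count (¬? ∘ (_≟ 0#)) elems   ≡⟨ count+count¬≡length (_≟ 0#) elems ⟩
    length elems                                       ≡⟨ length-elems ⟩
    q                                                  ≡⟨ q≡1+4j ⟩
    suc (j Nat.* 4)                                        ∎)
    where open ≡-Reasoning

  squares : List (Fin q)
  squares = filter square? units

  squares-unique : Unique squares
  squares-unique = UniqueP.filter⁺ _ units-unique

  squaring-two-to-one : ∀ s → s ∈ squares → count (λ x → x * x ≟ s) units ≡ 2
  squaring-two-to-one s s∈ with ∈-filter⁻ square? {xs = units} s∈
  ... | s∈units , (y , refl) = count-pair (λ x → x * x ≟ y * y) _≟_ units units-unique y (- y)
        (∈-units y≢0) (∈-units (-‿≢0 y y≢0)) (x≢-x y y≢0)
        (λ x _ → mk⇔ (x*x≡y*y⇒x≡±y x y) (λ { (inj₁ refl) → refl ; (inj₂ refl) → solve 1 (λ y → (:- y) :* (:- y) := y :* y) refl y }))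
    where
    y≢0 : y ≢ 0#
    y≢0 y≡0 = units-≢0 s∈units (trans (cong (λ w → w * w) y≡0) (zeroʳ 0#))

  length-squares : length squares ≡ j Nat.* 2
  length-squares = ℕP.*-cancelʳ-≡ (length squares) (j Nat.* 2) 2 (begin
    length squares Nat.* 2                        ≡⟨ cong (Nat._* 2) (sym (count-all (λ _ → yes tt) squares (λ _ _ → tt))) ⟩
    count (λ _ → yes tt) squares Nat.* 2          ≡⟨ sym (count-∘-constantFibres _≟_ (λ _ → yes tt) (λ x → x * x) units squares
                                                   squares-unique squared∈squares 2 squaring-two-to-one) ⟩
    count (λ _ → yes tt) units                ≡⟨ count-all (λ _ → yes tt) units (λ _ _ → tt) ⟩
    length units                              ≡⟨ length-units ⟩
    j Nat.* 4                                     ≡⟨ sym (ℕP.*-assoc j 2 2) ⟩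
    j Nat.* 2 Nat.* 2                                 ∎)
    where
    open ≡-Reasoning
    squared∈squares : ∀ x → x ∈ units → x * x ∈ squares
    squared∈squares x x∈ = ∈-filter⁺ square? (∈-units (*-≢0 x x (units-≢0 x∈) (units-≢0 x∈))) (x , refl)

  count-nonsquares : count (¬? ∘ square?) units ≡ j Nat.* 2
  count-nonsquares = ℕP.+-cancelˡ-≡ (j Nat.* 2) _ _ (begin
    j Nat.* 2 Nat.+ count (¬? ∘ square?) units               ≡⟨ cong (Nat._+ count (¬? ∘ square?) units) (sym length-squares) ⟩
    count square? units Nat.+ count (¬? ∘ square?) units ≡⟨ count+count¬≡length square? units ⟩
    length units                                     ≡⟨ length-units ⟩
    j Nat.* 4                                            ≡⟨ ℕP.*-distribˡ-+ j 2 2 ⟩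
    j Nat.* 2 Nat.+ j Nat.* 2                                    ∎)
    where open ≡-Reasoning

  -- Multiplication by a nonsquare n maps the units into the nonsquares; as there are
  -- equally many squares and nonsquares, every nonsquare arises, in particular m.
  nonsquare-*-nonsquare : ∀ n m → n ≢ 0# → ¬ IsSquare n → m ≢ 0# → ¬ IsSquare m → IsSquare (n * m)
  nonsquare-*-nonsquare n m n≢0 n-nonsq m≢0 m-nonsq = count-≡-⊆⇒⊇ (square? ∘ (n *_)) (¬? ∘ square?) units
      (λ y y∈ ny-sq y-sq → n-nonsq (square-cancelˡ y n (units-≢0 y∈) y-sq (subst IsSquare (*-comm n y) ny-sq)))
      (trans count-n*-squares (trans length-squares (sym count-nonsquares))) m (∈-units m≢0) m-nonsq
    where
    count-n*-squares : count (square? ∘ (n *_)) units ≡ length squares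
    count-n*-squares = count-∘-bijection square? units units-unique (n *_) (*-cancelˡ n _ _ n≢0)
      (λ x x∈ → ∈-units (*-≢0 n x n≢0 (units-≢0 x∈)))
      (λ y y∈ → inv n * y , ∈-units (*-≢0 (inv n) y (inv-≢0 n n≢0) (units-≢0 y∈)) ,
         trans (sym (*-assoc n (inv n) y)) (trans (cong (_* y) (*-inverseʳ n n≢0)) (*-identityˡ y)))

  0<j : 0 Nat.< j
  0<j = positive j q≡1+4j
    where
    all-equal : ∀ {n} → n ≡ 1 → (x y : Fin n) → x ≡ y
    all-equal refl zero zero = refl
    positive : ∀ k → q ≡ suc (k Nat.* 4) → 0 Nat.< k
    positive zero    q≡1 = ⊥-elim (0≢1 (all-equal q≡1 0# 1#))
    positive (suc _) _   = Nat.s≤s Nat.z≤n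

  ∃nonsquare : ∃ λ n → n ≢ 0# × ¬ IsSquare n
  ∃nonsquare with count>0⇒∃ (¬? ∘ square?) units (subst (0 Nat.<_) (sym count-nonsquares) (ℕP.*-monoˡ-< 2 0<j))
  ... | n , n∈ , n-nonsq = n , units-≢0 n∈ , n-nonsq

  -- Otherwise x ↦ inv x would be a fixed-point-free involution on the 2j − 1 squares other than 1.
  -1-square : IsSquare (- 1#)
  -1-square with square? (- 1#)
  ... | yes -1-sq = -1-sq
  ... | no -1-nonsq = ⊥-elim (2∣n⇒2∤1+n (involution-even inv inv-involutive others (UniqueP.filter⁺ _ squares-unique) inv-closed inv-fixpoint-free)
                      (subst (2 ∣_) (sym suc-length) (divides j refl)))
    where
    others = filter (λ y → ¬? (y ≟ 1#)) squares
    others⁻ : ∀ {y} → y ∈ others → (y ∈ units × IsSquare y) × y ≢ 1#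
    others⁻ {y} y∈ with ∈-filter⁻ (λ y → ¬? (y ≟ 1#)) {xs = squares} y∈
    ... | y∈squares , y≢1 = ∈-filter⁻ square? {xs = units} y∈squares , y≢1
    1∈squares : 1# ∈ squares
    1∈squares = ∈-filter⁺ square? (∈-units 1≢0) (1# , *-identityʳ 1#)
    suc-length : suc (length others) ≡ j Nat.* 2
    suc-length = begin
      suc (length others)                                         ≡⟨ cong (Nat._+ length others) (sym (count-≟ _≟_ squares squares-unique 1# 1∈squares)) ⟩
      count (_≟ 1#) squares Nat.+ count (¬? ∘ (_≟ 1#)) squares        ≡⟨ count+count¬≡length (_≟ 1#) squares ⟩
      length squares                                              ≡⟨ length-squares ⟩
      j Nat.* 2                                                       ∎
      where open ≡-Reasoning
    inv-closed : ∀ y → y ∈ others → inv y ∈ others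
    inv-closed y y∈ with others⁻ y∈
    ... | (y∈units , (r , refl)) , r²≢1 = ∈-filter⁺ (λ y → ¬? (y ≟ 1#))
          (∈-filter⁺ square? (∈-units (inv-≢0 _ (units-≢0 y∈units))) (inv r , sym inv-r²))
          (λ inv≡1 → r²≢1 (trans (sym (inv-involutive (r * r))) (trans (cong inv inv≡1) (sym (inv-unique 1# 1# 1≢0 (*-identityʳ 1#))))))
      where
      r≢0 : r ≢ 0#
      r≢0 r≡0 = units-≢0 y∈units (trans (cong (λ w → w * w) r≡0) (zeroʳ 0#))
      inv-r² : inv (r * r) ≡ inv r * inv r
      inv-r² = sym (inv-unique (r * r) (inv r * inv r) (units-≢0 y∈units)
        (trans (solve 2 (λ r r⁻¹ → r :* r :* (r⁻¹ :* r⁻¹) := (r :* r⁻¹) :* (r :* r⁻¹)) refl r (inv r))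
          (trans (cong (λ w → w * w) (*-inverseʳ r r≢0)) (*-identityʳ 1#))))
    inv-fixpoint-free : ∀ y → y ∈ others → inv y ≢ y
    inv-fixpoint-free y y∈ inv-y≡y with others⁻ y∈
    ... | (y∈units , y-sq) , y≢1 with x*x≡y*y⇒x≡±y y 1# (trans (cong (y *_) (sym inv-y≡y)) (trans (*-inverseʳ y (units-≢0 y∈units)) (sym (*-identityʳ 1#))))
    ...   | inj₁ y≡1  = y≢1 y≡1
    ...   | inj₂ y≡-1 = -1-nonsq (subst IsSquare y≡-1 y-sq)

module SpecialLinearGroup {q : ℕ} (F : FiniteField q) (j : ℕ) (q≡1+4j : q ≡ suc (j Nat.* 4)) where

  open FieldArithmetic F
  open Matrices F
  open QuadraticResidues F j q≡1+4j
  open Counting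

  _≟ₘ_ : DecidableEquality Mat
  _≟ₘ_ = ProductP.≡-dec _≟_ (ProductP.≡-dec _≟_ (ProductP.≡-dec _≟_ _≟_))

  row : Fin q → Fin q → Fin q → List Mat
  row a b c = map (λ d → (a , b , c , d)) elems

  plane : Fin q → Fin q → List Mat
  plane a b = concatMap (row a b) elems

  block : Fin q → List Mat
  block a = concatMap (plane a) elems

  matrices : List Mat
  matrices = concatMap block elems

  ∈-matrices : ∀ a b c d → (a , b , c , d) ∈ matrices
  ∈-matrices a b c d = ∈-concatMap⁺ block (lose (∈-allFin a) (∈-concatMap⁺ (plane a) (lose (∈-allFin b)
                         (∈-concatMap⁺ (row a b) (lose (∈-allFin c) (∈-map⁺ _ (∈-allFin d)))))))

  private
    ∈-row⁻ : ∀ {a b c m} → m ∈ row a b c → proj₁ m ≡ a × proj₁ (proj₂ m) ≡ b × proj₁ (proj₂ (proj₂ m)) ≡ c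
    ∈-row⁻ m∈ with ∈-map⁻ _ m∈
    ... | _ , _ , refl = refl , refl , refl

    ∈-plane⁻ : ∀ {a b m} → m ∈ plane a b → proj₁ m ≡ a × proj₁ (proj₂ m) ≡ b
    ∈-plane⁻ {a} {b} m∈ with find (∈-concatMap⁻ (row a b) {xs = elems} m∈)
    ... | _ , _ , m∈row = let (ma , mb , _) = ∈-row⁻ m∈row in ma , mb

    ∈-block⁻ : ∀ {a m} → m ∈ block a → proj₁ m ≡ a
    ∈-block⁻ {a} m∈ with find (∈-concatMap⁻ (plane a) {xs = elems} m∈)
    ... | _ , _ , m∈plane = proj₁ (∈-plane⁻ m∈plane)

  matrices-unique : Unique matrices
  matrices-unique = Unique-concatMap block elems elems! block-unique
      (λ _ _ m∈ m∈′ → trans (sym (∈-block⁻ m∈)) (∈-block⁻ m∈′))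
    where
    elems! = UniqueP.allFin⁺ q
    row-unique : ∀ a b c → Unique (row a b c)
    row-unique a b c = UniqueP.map⁺ (cong (λ m → proj₂ (proj₂ (proj₂ m)))) elems!
    plane-unique : ∀ a b → Unique (plane a b)
    plane-unique a b = Unique-concatMap (row a b) elems elems! (λ c _ → row-unique a b c)
      (λ _ _ m∈ m∈′ → trans (sym (proj₂ (proj₂ (∈-row⁻ m∈)))) (proj₂ (proj₂ (∈-row⁻ m∈′))))
    block-unique : ∀ a → a ∈ elems → Unique (block a)
    block-unique a _ = Unique-concatMap (plane a) elems elems! (λ b _ → plane-unique a b)
      (λ _ _ m∈ m∈′ → trans (sym (proj₂ (∈-plane⁻ m∈))) (proj₂ (∈-plane⁻ m∈′)))

  SL2-unique : Unique SL2
  SL2-unique = UniqueP.filter⁺ _ matrices-unique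

  ∈-SL2⁺ : ∀ m → det m ≡ 1# → m ∈ SL2
  ∈-SL2⁺ (a , b , c , d) det≡1 = ∈-filter⁺ _ (∈-matrices a b c d) det≡1

  ∈-SL2⁻ : ∀ m → m ∈ SL2 → det m ≡ 1#
  ∈-SL2⁻ (a , b , c , d) m∈ = proj₂ (∈-filter⁻ _ {xs = matrices} m∈)

  SL2-det-≢0 : ∀ m → m ∈ SL2 → det m ≢ 0#
  SL2-det-≢0 m m∈ det≡0 = 1≢0 (trans (sym (∈-SL2⁻ m m∈)) det≡0)

  scale-injective : ∀ k l m → k ≢ l → det m ≢ 0# → scale k m ≢ scale l m
  scale-injective k l (a , b , c , d) k≢l det≢0 km≡lm = det≢0 (begin
    a * d - b * c     ≡⟨ cong₂ (λ x y → x * d - y * c) (vanishes a (cong proj₁ km≡lm)) (vanishes b (cong (proj₁ ∘ proj₂) km≡lm)) ⟩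
    0# * d - 0# * c   ≡⟨ solve 2 (λ c d → :0 :* d :- :0 :* c := :0) refl c d ⟩
    0#                ∎)
    where
    open ≡-Reasoning
    vanishes : ∀ x → k * x ≡ l * x → x ≡ 0#
    vanishes x kx≡lx = x*y≡0⇒y≡0 (k - l) x (x≢y⇒x-y≢0 k l k≢l) (begin
      (k - l) * x      ≡⟨ solve 3 (λ k l x → (k :- l) :* x := k :* x :- l :* x) refl k l x ⟩
      k * x - l * x    ≡⟨ cong (_- l * x) kx≡lx ⟩
      l * x - l * x    ≡⟨ solve 2 (λ l x → l :* x :- l :* x := :0) refl l x ⟩
      0#               ∎)

  -- The elements of SL(2,q) in the line {k V | k ≢ 0} are the k V with k² det V = 1.
  module ScalarMultiples (V : Mat) (det-V≢0 : det V ≢ 0#) {P : Mat → Set} (P? : Decidable P)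
           (scale-P : ∀ k → k ≢ 0# → P (scale k V))
           (P⇒scale : ∀ m → det m ≢ 0# → P m → ∃ λ k → k ≢ 0# × m ≡ scale k V) where

    count-square : IsSquare (det V) → count P? SL2 ≡ 2
    count-square (s , s²≡detV) = count-pair P? _≟ₘ_ SL2 SL2-unique (scale i V) (scale (- i) V)
        (∈-SL2⁺ _ (det-scale-unit i refl)) (∈-SL2⁺ _ (det-scale-unit (- i) (solve 1 (λ i → (:- i) :* (:- i) := i :* i) refl i)))
        (scale-injective i (- i) V (x≢-x i i≢0) det-V≢0)
        (λ m m∈ → mk⇔ (solutions m m∈) λ { (inj₁ refl) → scale-P i i≢0 ; (inj₂ refl) → scale-P (- i) (-‿≢0 i i≢0) })
      where
      s≢0 : s ≢ 0#
      s≢0 s≡0 = det-V≢0 (trans (sym s²≡detV) (trans (cong (λ w → w * w) s≡0) (zeroʳ 0#)))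
      i = inv s
      i≢0 = inv-≢0 s s≢0
      det-scale-unit : ∀ k → k * k ≡ i * i → det (scale k V) ≡ 1#
      det-scale-unit k k²≡i² = begin
        det (scale k V)       ≡⟨ det-scale k V ⟩
        k * k * det V         ≡⟨ cong₂ _*_ k²≡i² (sym s²≡detV) ⟩
        i * i * (s * s)       ≡⟨ solve 2 (λ i s → i :* i :* (s :* s) := (i :* s) :* (i :* s)) refl i s ⟩
        (i * s) * (i * s)     ≡⟨ cong (λ w → w * w) (*-inverseˡ s s≢0) ⟩
        1# * 1#               ≡⟨ *-identityʳ 1# ⟩
        1#                    ∎
        where open ≡-Reasoning
      solutions : ∀ m → m ∈ SL2 → P m → m ≡ scale i V ⊎ m ≡ scale (- i) V
      solutions m m∈ Pm with P⇒scale m (SL2-det-≢0 m m∈) Pm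
      ... | k , _ , m≡kV = from-root (x*x≡y*y⇒x≡±y (k * s) 1# ks²≡1²)
        where
        open ≡-Reasoning
        ks²≡1² : k * s * (k * s) ≡ 1# * 1#
        ks²≡1² = begin
          k * s * (k * s)        ≡⟨ solve 2 (λ k s → k :* s :* (k :* s) := k :* k :* (s :* s)) refl k s ⟩
          k * k * (s * s)        ≡⟨ cong (k * k *_) s²≡detV ⟩
          k * k * det V          ≡⟨ sym (det-scale k V) ⟩
          det (scale k V)        ≡⟨ cong det (sym m≡kV) ⟩
          det m                  ≡⟨ ∈-SL2⁻ m m∈ ⟩
          1#                     ≡⟨ sym (*-identityʳ 1#) ⟩
          1# * 1#                ∎
        k≡ : ∀ c → k * s ≡ c → k ≡ c * i
        k≡ c ks≡c = begin
          k                  ≡⟨ sym (*-identityʳ k) ⟩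
          k * 1#             ≡⟨ cong (k *_) (sym (*-inverseʳ s s≢0)) ⟩
          k * (s * i)        ≡⟨ sym (*-assoc k s i) ⟩
          k * s * i          ≡⟨ cong (_* i) ks≡c ⟩
          c * i              ∎
        from-root : k * s ≡ 1# ⊎ k * s ≡ - 1# → m ≡ scale i V ⊎ m ≡ scale (- i) V
        from-root (inj₁ ks≡1)  = inj₁ (trans m≡kV (cong (λ x → scale x V) (trans (k≡ 1# ks≡1) (*-identityˡ i))))
        from-root (inj₂ ks≡-1) = inj₂ (trans m≡kV (cong (λ x → scale x V) (trans (k≡ (- 1#) ks≡-1)
                                   (solve 1 (λ i → (:- :1) :* i := :- i) refl i))))

    count-nonsquare : ¬ IsSquare (det V) → count P? SL2 ≡ 0
    count-nonsquare nonsquare = count-none P? SL2 λ m m∈ Pm → no-solution m m∈ (P⇒scale m (SL2-det-≢0 m m∈) Pm)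
      where
      no-solution : ∀ m → m ∈ SL2 → ¬ (∃ λ k → k ≢ 0# × m ≡ scale k V)
      no-solution m m∈ (k , k≢0 , m≡kV) = nonsquare (inv k , sym (begin
        det V                                ≡⟨ solve 1 (λ x → x := :1 :* :1 :* x) refl (det V) ⟩
        1# * 1# * det V                      ≡⟨ cong (λ x → x * x * det V) (sym (*-inverseˡ k k≢0)) ⟩
        inv k * k * (inv k * k) * det V      ≡⟨ solve 3 (λ k⁻¹ k x → k⁻¹ :* k :* (k⁻¹ :* k) :* x := (k :* k :* x) :* (k⁻¹ :* k⁻¹)) refl (inv k) k (det V) ⟩
        (k * k * det V) * (inv k * inv k)    ≡⟨ cong (_* (inv k * inv k)) (trans (sym (det-scale k V)) (trans (cong det (sym m≡kV)) (∈-SL2⁻ m m∈))) ⟩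
        1# * (inv k * inv k)                 ≡⟨ *-identityˡ _ ⟩
        inv k * inv k                        ∎))
        where open ≡-Reasoning

module TriplesOf {q : ℕ} (B : Subset q) where

  open Counting
  open import Data.Fin using (_<_; _<?_)
  open Subset using () renaming (_∈_ to _∈ˢ_)

  Triple : Set
  Triple = Fin q × Fin q × Fin q

  firsts : List (Fin q)
  firsts = filter (_∈? B) (allFin q)

  seconds : Fin q → List (Fin q)
  seconds x = filter (λ y → (y ∈? B) ×-dec (x <? y)) (allFin q)

  thirds : Fin q → Fin q → List (Fin q)
  thirds x y = filter (λ z → (z ∈? B) ×-dec (y <? z)) (allFin q)

  sortedTriples : List Triple
  sortedTriples = concatMap (λ x → concatMap (λ y → map (λ z → (x , y , z)) (thirds x y)) (seconds x)) firsts

  Sorted : Triple → Set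
  Sorted (x , y , z) = x ∈ˢ B × y ∈ˢ B × z ∈ˢ B × x < y × y < z

  InB : Triple → Set
  InB (x , y , z) = x ∈ˢ B × y ∈ˢ B × z ∈ˢ B

  Distinct : Triple → Set
  Distinct (x , y , z) = x ≢ y × y ≢ z × x ≢ z

  ∈-sortedTriples⁻ : ∀ s → s ∈ sortedTriples → Sorted s
  ∈-sortedTriples⁻ s s∈ with find (∈-concatMap⁻ (λ x → concatMap (λ y → map (λ z → (x , y , z)) (thirds x y)) (seconds x)) {xs = firsts} s∈)
  ... | x , x∈ , s∈x with find (∈-concatMap⁻ (λ y → map (λ z → (x , y , z)) (thirds x y)) {xs = seconds x} s∈x)
  ... | y , y∈ , s∈xy with ∈-map⁻ (λ z → (x , y , z)) s∈xy
  ... | z , z∈ , refl with ∈-filter⁻ (_∈? B) {xs = allFin q} x∈ | ∈-filter⁻ (λ y → (y ∈? B) ×-dec (x <? y)) {xs = allFin q} y∈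
                         | ∈-filter⁻ (λ z → (z ∈? B) ×-dec (y <? z)) {xs = allFin q} z∈
  ... | _ , x∈B | _ , (y∈B , x<y) | _ , (z∈B , y<z) = x∈B , y∈B , z∈B , x<y , y<z

  ∈-sortedTriples⁺ : ∀ x y z → Sorted (x , y , z) → (x , y , z) ∈ sortedTriples
  ∈-sortedTriples⁺ x y z (x∈B , y∈B , z∈B , x<y , y<z) =
    ∈-concatMap⁺ _ (lose (∈-filter⁺ (_∈? B) (∈-allFin x) x∈B)
      (∈-concatMap⁺ _ (lose (∈-filter⁺ (λ y → (y ∈? B) ×-dec (x <? y)) (∈-allFin y) (y∈B , x<y))
        (∈-map⁺ _ (∈-filter⁺ (λ z → (z ∈? B) ×-dec (y <? z)) (∈-allFin z) (z∈B , y<z))))))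

  sortedTriples-unique : Unique sortedTriples
  sortedTriples-unique = Unique-concatMap _ firsts (UniqueP.filter⁺ _ fin!)
      (λ x _ → Unique-concatMap _ (seconds x) (UniqueP.filter⁺ _ fin!)
        (λ y _ → UniqueP.map⁺ (cong (proj₂ ∘ proj₂)) (UniqueP.filter⁺ _ fin!))
        (λ _ _ s∈ s∈′ → trans (sym (second s∈)) (second s∈′)))
      (λ _ _ s∈ s∈′ → trans (sym (first s∈)) (first s∈′))
    where
    fin! = UniqueP.allFin⁺ q
    second : ∀ {x y s} → s ∈ map (λ z → (x , y , z)) (thirds x y) → proj₁ (proj₂ s) ≡ y
    second s∈ with ∈-map⁻ _ s∈
    ... | _ , _ , refl = refl
    first : ∀ {x s} → s ∈ concatMap (λ y → map (λ z → (x , y , z)) (thirds x y)) (seconds x) → proj₁ s ≡ x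
    first {x} s∈ with find (∈-concatMap⁻ (λ y → map (λ z → (x , y , z)) (thirds x y)) {xs = seconds x} s∈)
    ... | _ , _ , s∈′ with ∈-map⁻ _ s∈′
    ...   | _ , _ , refl = refl

  arrangements : Triple → List Triple
  arrangements (x , y , z) = (x , y , z) ∷ (y , z , x) ∷ (z , x , y) ∷ (y , x , z) ∷ (x , z , y) ∷ (z , y , x) ∷ []

  orderedTriples : List Triple
  orderedTriples = concatMap arrangements sortedTriples

  _∈₃_ : Fin q → Triple → Set
  w ∈₃ (x , y , z) = w ≡ x ⊎ w ≡ y ⊎ w ≡ z

  _⊆₃_ : Triple → Triple → Set
  (x , y , z) ⊆₃ s = x ∈₃ s × y ∈₃ s × z ∈₃ s

  ⊆₃-trans : ∀ s t u → s ⊆₃ t → t ⊆₃ u → s ⊆₃ u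
  ⊆₃-trans (x , y , z) (a , b , c) u (x∈ , y∈ , z∈) (a∈ , b∈ , c∈) = lift x∈ , lift y∈ , lift z∈
    where
    lift : ∀ {w} → w ∈₃ (a , b , c) → w ∈₃ u
    lift (inj₁ refl)        = a∈
    lift (inj₂ (inj₁ refl)) = b∈
    lift (inj₂ (inj₂ refl)) = c∈

  at₁ : ∀ {x y z} → x ∈₃ (x , y , z)
  at₁ = inj₁ refl

  at₂ : ∀ {x y z} → y ∈₃ (x , y , z)
  at₂ = inj₂ (inj₁ refl)

  at₃ : ∀ {x y z} → z ∈₃ (x , y , z)
  at₃ = inj₂ (inj₂ refl)

  arrangement-⊆₃ : ∀ s t → t ∈ arrangements s → t ⊆₃ s × s ⊆₃ t
  arrangement-⊆₃ (x , y , z) _ (here refl)                                 = (at₁ , at₂ , at₃) , (at₁ , at₂ , at₃)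
  arrangement-⊆₃ (x , y , z) _ (there (here refl))                         = (at₂ , at₃ , at₁) , (at₃ , at₁ , at₂)
  arrangement-⊆₃ (x , y , z) _ (there (there (here refl)))                 = (at₃ , at₁ , at₂) , (at₂ , at₃ , at₁)
  arrangement-⊆₃ (x , y , z) _ (there (there (there (here refl))))         = (at₂ , at₁ , at₃) , (at₂ , at₁ , at₃)
  arrangement-⊆₃ (x , y , z) _ (there (there (there (there (here refl))))) = (at₁ , at₃ , at₂) , (at₁ , at₃ , at₂)
  arrangement-⊆₃ (x , y , z) _ (there (there (there (there (there (here refl)))))) = (at₃ , at₂ , at₁) , (at₃ , at₂ , at₁)

  -- The least and the greatest elements of a sorted triple are determined by its underlying set.
  sorted-⊆₃-antisym : ∀ s s′ → Sorted s → Sorted s′ → s ⊆₃ s′ → s′ ⊆₃ s → s ≡ s′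
  sorted-⊆₃-antisym (a , b , c) (a′ , b′ , c′) (_ , _ , _ , a<b , b<c) (_ , _ , _ , a′<b′ , b′<c′) (a∈ , b∈ , c∈) (a′∈ , _ , c′∈) =
    middle a<b b<c a≡a′ c≡c′ b∈
    where
    not-below : ∀ {x y z w} → x < y → y < z → w ∈₃ (x , y , z) → ¬ w < x
    not-below x<y y<z (inj₁ refl)        w<x = <-irrefl refl w<x
    not-below x<y y<z (inj₂ (inj₁ refl)) w<x = <-asym x<y w<x
    not-below x<y y<z (inj₂ (inj₂ refl)) w<x = <-asym (<-trans x<y y<z) w<x
    not-above : ∀ {x y z w} → x < y → y < z → w ∈₃ (x , y , z) → ¬ z < w
    not-above x<y y<z (inj₁ refl)        z<w = <-asym (<-trans x<y y<z) z<w
    not-above x<y y<z (inj₂ (inj₁ refl)) z<w = <-asym y<z z<w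
    not-above x<y y<z (inj₂ (inj₂ refl)) z<w = <-irrefl refl z<w
    a≡a′ : a ≡ a′
    a≡a′ with <-cmp a a′
    ... | tri< a<a′ _ _ = ⊥-elim (not-below a′<b′ b′<c′ a∈ a<a′)
    ... | tri≈ _ a≡a′ _ = a≡a′
    ... | tri> _ _ a′<a = ⊥-elim (not-below a<b b<c a′∈ a′<a)
    c≡c′ : c ≡ c′
    c≡c′ with <-cmp c c′
    ... | tri< c<c′ _ _ = ⊥-elim (not-above a<b b<c c′∈ c<c′)
    ... | tri≈ _ c≡c′ _ = c≡c′
    ... | tri> _ _ c′<c = ⊥-elim (not-above a′<b′ b′<c′ c∈ c′<c)
    middle : ∀ {x y z x′ y′ z′} → x < y → y < z → x ≡ x′ → z ≡ z′ → y ∈₃ (x′ , y′ , z′) → (x , y , z) ≡ (x′ , y′ , z′)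
    middle x<y y<z refl refl (inj₁ refl)        = ⊥-elim (<-irrefl refl x<y)
    middle x<y y<z refl refl (inj₂ (inj₁ refl)) = refl
    middle x<y y<z refl refl (inj₂ (inj₂ refl)) = ⊥-elim (<-irrefl refl y<z)

  Sorted⇒Distinct : ∀ s → Sorted s → InB s × Distinct s
  Sorted⇒Distinct (a , b , c) (a∈B , b∈B , c∈B , a<b , b<c) = (a∈B , b∈B , c∈B) , (<⇒≢ a<b , <⇒≢ b<c , <⇒≢ (<-trans a<b b<c))
    where
    <⇒≢ : ∀ {x y} → x < y → x ≢ y
    <⇒≢ x<y refl = <-irrefl refl x<y

  arrangement-Distinct : ∀ s t → t ∈ arrangements s → InB s × Distinct s → InB t × Distinct t
  arrangement-Distinct (x , y , z) _ (here refl) h = h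
  arrangement-Distinct (x , y , z) _ (there (here refl)) ((x∈ , y∈ , z∈) , (x≢y , y≢z , x≢z)) =
    (y∈ , z∈ , x∈) , (y≢z , x≢z ∘ sym , x≢y ∘ sym)
  arrangement-Distinct (x , y , z) _ (there (there (here refl))) ((x∈ , y∈ , z∈) , (x≢y , y≢z , x≢z)) =
    (z∈ , x∈ , y∈) , (x≢z ∘ sym , x≢y , y≢z ∘ sym)
  arrangement-Distinct (x , y , z) _ (there (there (there (here refl)))) ((x∈ , y∈ , z∈) , (x≢y , y≢z , x≢z)) =
    (y∈ , x∈ , z∈) , (x≢y ∘ sym , x≢z , y≢z)
  arrangement-Distinct (x , y , z) _ (there (there (there (there (here refl))))) ((x∈ , y∈ , z∈) , (x≢y , y≢z , x≢z)) =
    (x∈ , z∈ , y∈) , (x≢z , y≢z ∘ sym , x≢y)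
  arrangement-Distinct (x , y , z) _ (there (there (there (there (there (here refl)))))) ((x∈ , y∈ , z∈) , (x≢y , y≢z , x≢z)) =
    (z∈ , y∈ , x∈) , (y≢z ∘ sym , x≢y ∘ sym , x≢z ∘ sym)

  ∈-orderedTriples⁻ : ∀ t → t ∈ orderedTriples → InB t × Distinct t
  ∈-orderedTriples⁻ t t∈ with find (∈-concatMap⁻ arrangements {xs = sortedTriples} t∈)
  ... | s , s∈ , t∈s = arrangement-Distinct s t t∈s (Sorted⇒Distinct s (∈-sortedTriples⁻ s s∈))

  ∈-arrangements⇒∈-orderedTriples : ∀ a b c {t} → Sorted (a , b , c) → t ∈ arrangements (a , b , c) → t ∈ orderedTriples
  ∈-arrangements⇒∈-orderedTriples a b c sorted t∈ = ∈-concatMap⁺ arrangements (lose (∈-sortedTriples⁺ a b c sorted) t∈)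

  ∈-orderedTriples⁺ : ∀ x y z → InB (x , y , z) → Distinct (x , y , z) → (x , y , z) ∈ orderedTriples
  ∈-orderedTriples⁺ x y z (x∈ , y∈ , z∈) (x≢y , y≢z , x≢z) with <-cmp x y | <-cmp y z | <-cmp x z
  ... | tri≈ _ x≡y _ | _ | _ = ⊥-elim (x≢y x≡y)
  ... | _ | tri≈ _ y≡z _ | _ = ⊥-elim (y≢z y≡z)
  ... | _ | _ | tri≈ _ x≡z _ = ⊥-elim (x≢z x≡z)
  ... | tri< x<y _ _ | tri< y<z _ _ | _            = ∈-arrangements⇒∈-orderedTriples x y z (x∈ , y∈ , z∈ , x<y , y<z) (here refl)
  ... | tri< x<y _ _ | tri> _ _ z<y | tri< x<z _ _ = ∈-arrangements⇒∈-orderedTriples x z y (x∈ , z∈ , y∈ , x<z , z<y) (there (there (there (there (here refl)))))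
  ... | tri< x<y _ _ | tri> _ _ z<y | tri> _ _ z<x = ∈-arrangements⇒∈-orderedTriples z x y (z∈ , x∈ , y∈ , z<x , x<y) (there (here refl))
  ... | tri> _ _ y<x | tri< y<z _ _ | tri< x<z _ _ = ∈-arrangements⇒∈-orderedTriples y x z (y∈ , x∈ , z∈ , y<x , x<z) (there (there (there (here refl))))
  ... | tri> _ _ y<x | tri< y<z _ _ | tri> _ _ z<x = ∈-arrangements⇒∈-orderedTriples y z x (y∈ , z∈ , x∈ , y<z , z<x) (there (there (here refl)))
  ... | tri> _ _ y<x | tri> _ _ z<y | _            = ∈-arrangements⇒∈-orderedTriples z y x (z∈ , y∈ , x∈ , z<y , y<x) (there (there (there (there (there (here refl))))))

  arrangements-unique : ∀ s → Distinct s → Unique (arrangements s)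
  arrangements-unique (x , y , z) (x≢y , y≢z , x≢z) =
    (≢₁ x≢y ∷ ≢₁ x≢z ∷ ≢₁ x≢y ∷ ≢₂ y≢z ∷ ≢₁ x≢z ∷ []) ∷
    (≢₁ y≢z ∷ ≢₂ (x≢z ∘ sym) ∷ ≢₁ (x≢y ∘ sym) ∷ ≢₁ y≢z ∷ []) ∷
    (≢₁ (y≢z ∘ sym) ∷ ≢₁ (x≢z ∘ sym) ∷ ≢₂ x≢y ∷ []) ∷
    (≢₁ (x≢y ∘ sym) ∷ ≢₁ y≢z ∷ []) ∷
    (≢₁ x≢z ∷ []) ∷
    [] ∷ []
    where
    ≢₁ : ∀ {a b c a′ b′ c′ : Fin q} → a ≢ a′ → (a , b , c) ≢ (a′ , b′ , c′)
    ≢₁ a≢a′ eq = a≢a′ (cong proj₁ eq)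
    ≢₂ : ∀ {a b c a′ b′ c′ : Fin q} → b ≢ b′ → (a , b , c) ≢ (a′ , b′ , c′)
    ≢₂ b≢b′ eq = b≢b′ (cong (proj₁ ∘ proj₂) eq)

  orderedTriples-unique : Unique orderedTriples
  orderedTriples-unique = Unique-concatMap arrangements sortedTriples sortedTriples-unique
    (λ s s∈ → arrangements-unique s (proj₂ (Sorted⇒Distinct s (∈-sortedTriples⁻ s s∈))))
    (λ {s} {s′} {t} s∈ s′∈ t∈ t∈′ →
       let (t⊆s , s⊆t) = arrangement-⊆₃ s t t∈
           (t⊆s′ , s′⊆t) = arrangement-⊆₃ s′ t t∈′
       in sorted-⊆₃-antisym s s′ (∈-sortedTriples⁻ s s∈) (∈-sortedTriples⁻ s′ s′∈)
            (⊆₃-trans s t s′ s⊆t t⊆s′) (⊆₃-trans s′ t s s′⊆t t⊆s))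

  count-orderedTriples : {P : Triple → Set} (P? : Decidable P) → (∀ s t → t ∈ arrangements s → P t ⇔ P s) →
    count P? orderedTriples ≡ 6 Nat.* count P? sortedTriples
  count-orderedTriples {P} P? invariant = begin
    count P? orderedTriples                           ≡⟨ count-concatMap P? arrangements sortedTriples ⟩
    ∑ (count P? ∘ arrangements) sortedTriples         ≡⟨ ∑-cong sortedTriples (λ s _ → six-times s) ⟩
    ∑ (λ s → indicator (P? s) Nat.* 6) sortedTriples  ≡⟨ ∑-*ʳ 6 (indicator ∘ P?) sortedTriples ⟩
    ∑ (indicator ∘ P?) sortedTriples Nat.* 6          ≡⟨ cong (Nat._* 6) (sym (count≡∑ P? sortedTriples)) ⟩
    count P? sortedTriples Nat.* 6                    ≡⟨ ℕP.*-comm (count P? sortedTriples) 6 ⟩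
    6 Nat.* count P? sortedTriples                    ∎
    where
    open ≡-Reasoning
    constant : ∀ s (d : Dec (P s)) → count (λ _ → d) (arrangements s) ≡ indicator d Nat.* 6
    constant s (yes _) = refl
    constant s (no _)  = refl
    six-times : ∀ s → count P? (arrangements s) ≡ indicator (P? s) Nat.* 6
    six-times s = trans (count-cong P? (λ _ → P? s) (arrangements s) (invariant s)) (constant s (P? s))

module BlockCounting {q : ℕ} (F : FiniteField q) (j : ℕ) (q≡1+4j : q ≡ suc (j Nat.* 4)) (B : Subset q) where

  open FieldArithmetic F
  open Matrices F
  open ThreeTransitivity F
  open QuadraticResidues F j q≡1+4j
  open SpecialLinearGroup F j q≡1+4j
  open TriplesOf B
  open SubsetFacts
  open Counting
  open Subset using () renaming (_∈_ to _∈ˢ_)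

  elementsOfB : List (Fin q)
  elementsOfB = filter (_∈? B) elems

  ∈-elementsOfB⁻ : ∀ {x} → x ∈ elementsOfB → x ∈ˢ B
  ∈-elementsOfB⁻ x∈ = proj₂ (∈-filter⁻ (_∈? B) {xs = elems} x∈)

  inImage : Mat → Point → Bool
  inImage g p = if ⌊ any? (λ x → act g (suc x) ≟ p) elementsOfB ⌋ then inside else outside

  ∈-image⁻ : ∀ g p → p ∈ˢ image g B → ∃ λ x → x ∈ˢ B × act g (suc x) ≡ p
  ∈-image⁻ g p p∈ with find (if-inside⁻ (any? (λ x → act g (suc x) ≟ p) elementsOfB)
                          (∈-tabulate⁻ (inImage g) p p∈))
  ... | x , x∈ , gx≡p = x , ∈-elementsOfB⁻ x∈ , gx≡p

  ∈-image⁺ : ∀ g p x → x ∈ˢ B → act g (suc x) ≡ p → p ∈ˢ image g B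
  ∈-image⁺ g p x x∈B gx≡p = ∈-tabulate⁺ (inImage g) p
    (if-inside⁺ (any? (λ x → act g (suc x) ≟ p) elementsOfB) (lose (∈-filter⁺ (_∈? B) (∈-allFin x) x∈B) gx≡p))

  inTriple : Point → Point → Point → Point → Bool
  inTriple x y z p = if ⌊ p ≟ x ⌋ then inside else if ⌊ p ≟ y ⌋ then inside else if ⌊ p ≟ z ⌋ then inside else outside

  ∈-triple⁻ : ∀ x y z p → p ∈ˢ triple x y z → p ≡ x ⊎ p ≡ y ⊎ p ≡ z
  ∈-triple⁻ x y z p p∈ = which (p ≟ x) (p ≟ y) (p ≟ z) (∈-tabulate⁻ (inTriple x y z) p p∈)
    where
    which : (a : Dec (p ≡ x)) (b : Dec (p ≡ y)) (c : Dec (p ≡ z)) →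
      (if ⌊ a ⌋ then inside else if ⌊ b ⌋ then inside else if ⌊ c ⌋ then inside else outside) ≡ true → p ≡ x ⊎ p ≡ y ⊎ p ≡ z
    which (yes p≡x) _         _         _ = inj₁ p≡x
    which (no _)    (yes p≡y) _         _ = inj₂ (inj₁ p≡y)
    which (no _)    (no _)    (yes p≡z) _ = inj₂ (inj₂ p≡z)

  ∈-triple⁺ : ∀ x y z p → p ≡ x ⊎ p ≡ y ⊎ p ≡ z → p ∈ˢ triple x y z
  ∈-triple⁺ x y z p p∈ = ∈-tabulate⁺ (inTriple x y z) p (inside-if (p ≟ x) (p ≟ y) (p ≟ z) p∈)
    where
    inside-if : (a : Dec (p ≡ x)) (b : Dec (p ≡ y)) (c : Dec (p ≡ z)) → p ≡ x ⊎ p ≡ y ⊎ p ≡ z →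
      (if ⌊ a ⌋ then inside else if ⌊ b ⌋ then inside else if ⌊ c ⌋ then inside else outside) ≡ true
    inside-if (yes _) _       _       _                 = refl
    inside-if (no _)  (yes _) _       _                 = refl
    inside-if (no _)  (no _)  (yes _) _                 = refl
    inside-if (no ¬a) (no _)  (no _)  (inj₁ p≡x)        = ⊥-elim (¬a p≡x)
    inside-if (no _)  (no ¬b) (no _)  (inj₂ (inj₁ p≡y)) = ⊥-elim (¬b p≡y)
    inside-if (no _)  (no _)  (no ¬c) (inj₂ (inj₂ p≡z)) = ⊥-elim (¬c p≡z)

  triple-⊆⁻ : ∀ x y z D → triple x y z ⊆ D → x ∈ˢ D × y ∈ˢ D × z ∈ˢ D
  triple-⊆⁻ x y z D sub = sub (∈-triple⁺ x y z x (inj₁ refl)) , sub (∈-triple⁺ x y z y (inj₂ (inj₁ refl))) ,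
                          sub (∈-triple⁺ x y z z (inj₂ (inj₂ refl)))

  triple-⊆⁺ : ∀ x y z D → x ∈ˢ D → y ∈ˢ D → z ∈ˢ D → triple x y z ⊆ D
  triple-⊆⁺ x y z D x∈ y∈ z∈ {p} p∈ with ∈-triple⁻ x y z p p∈
  ... | inj₁ refl        = x∈
  ... | inj₂ (inj₁ refl) = y∈
  ... | inj₂ (inj₂ refl) = z∈

  Δ : Triple → Fin q
  Δ (x , y , z) = (x - y) * (y - z) * (z - x)

  Δ-≢0 : ∀ b → Distinct b → Δ b ≢ 0#
  Δ-≢0 (x , y , z) (x≢y , y≢z , x≢z) =
    *-≢0 _ _ (*-≢0 _ _ (x≢y⇒x-y≢0 x y x≢y) (x≢y⇒x-y≢0 y z y≢z)) (x≢y⇒x-y≢0 z x (x≢z ∘ sym))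

  det-frame-Δ : ∀ x y z → det (frame (suc x) (suc y) (suc z)) ≡ Δ (x , y , z)
  det-frame-Δ x y z = trans (det-frame (suc x) (suc y) (suc z)) (solve 3 (λ x y z →
    (y :* :1 :- x :* :1) :* (z :* :1 :- y :* :1) :* (z :* :1 :- x :* :1) := (x :- y) :* (y :- z) :* (z :- x)) refl x y z)

  Distinct⇒Distinct₃ : ∀ {x y z} → Distinct (x , y , z) → Distinct₃ (suc x) (suc y) (suc z)
  Distinct⇒Distinct₃ (x≢y , y≢z , x≢z) = x≢y ∘ suc-injective , y≢z ∘ suc-injective , x≢z ∘ suc-injective

  module Through {t₁ t₂ t₃ : Point} (dt : Distinct₃ t₁ t₂ t₃) where

    T : Subset (suc q)
    T = triple t₁ t₂ t₃

    Dt : Fin q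
    Dt = det (frame t₁ t₂ t₃)

    t₁≢t₂ : t₁ ≢ t₂
    t₁≢t₂ = proj₁ dt

    t₂≢t₃ : t₂ ≢ t₃
    t₂≢t₃ = proj₁ (proj₂ dt)

    t₁≢t₃ : t₁ ≢ t₃
    t₁≢t₃ = proj₂ (proj₂ dt)

    SendsToT : Mat → Triple → Set
    SendsToT g (x , y , z) = Sends g (suc x) (suc y) (suc z) t₁ t₂ t₃

    sends? : ∀ g b → Dec (SendsToT g b)
    sends? g (x , y , z) = (act g (suc x) ≟ t₁) ×-dec (act g (suc y) ≟ t₂) ×-dec (act g (suc z) ≟ t₃)

    contains≡count-sends : ∀ g → g ∈ SL2 → indicator (T ⊆? image g B) ≡ count (sends? g) orderedTriples
    contains≡count-sends g g∈ with T ⊆? image g B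
    ... | no T⊈gB = sym (count-none (sends? g) orderedTriples λ { (x , y , z) b∈ (gx≡t₁ , gy≡t₂ , gz≡t₃) →
          let ((x∈B , y∈B , z∈B) , _) = ∈-orderedTriples⁻ (x , y , z) b∈ in
          T⊈gB (triple-⊆⁺ t₁ t₂ t₃ (image g B) (∈-image⁺ g t₁ x x∈B gx≡t₁) (∈-image⁺ g t₂ y y∈B gy≡t₂) (∈-image⁺ g t₃ z z∈B gz≡t₃)) })
    ... | yes T⊆gB with triple-⊆⁻ t₁ t₂ t₃ (image g B) T⊆gB
    ...   | t₁∈ , t₂∈ , t₃∈ with ∈-image⁻ g t₁ t₁∈ | ∈-image⁻ g t₂ t₂∈ | ∈-image⁻ g t₃ t₃∈
    ...     | x , x∈B , gx≡t₁ | y , y∈B , gy≡t₂ | z , z∈B , gz≡t₃ =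
      sym (count-singleton (sends? g) orderedTriples orderedTriples-unique (x , y , z) b∈ (λ b _ → mk⇔ (only b) λ { refl → gx≡t₁ , gy≡t₂ , gz≡t₃ }))
      where
      g-injective : ∀ {u v} → act g (suc u) ≡ act g (suc v) → u ≡ v
      g-injective e = suc-injective (act-injective g (SL2-det-≢0 g g∈) e)
      b∈ : (x , y , z) ∈ orderedTriples
      b∈ = ∈-orderedTriples⁺ x y z (x∈B , y∈B , z∈B)
             ( (λ x≡y → t₁≢t₂ (trans (sym gx≡t₁) (trans (cong (act g ∘ suc) x≡y) gy≡t₂)))
             , (λ y≡z → t₂≢t₃ (trans (sym gy≡t₂) (trans (cong (act g ∘ suc) y≡z) gz≡t₃)))
             , (λ x≡z → t₁≢t₃ (trans (sym gx≡t₁) (trans (cong (act g ∘ suc) x≡z) gz≡t₃))))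
      only : ∀ b → SendsToT g b → b ≡ (x , y , z)
      only (u , v , w) (gu≡t₁ , gv≡t₂ , gw≡t₃) = cong₂ _,_ (g-injective (trans gu≡t₁ (sym gx≡t₁)))
        (cong₂ _,_ (g-injective (trans gv≡t₂ (sym gy≡t₂))) (g-injective (trans gw≡t₃ (sym gz≡t₃))))

    module SendersOf {x y z : Fin q} (db : Distinct (x , y , z)) where
      open Transport (Distinct⇒Distinct₃ db) dt public
      open ScalarMultiples transport det-transport-≢0 (λ g → sends? g (x , y , z)) scale-transport-sends sends⇒scale-transport public

      det-transport≡DtΔ : det transport ≡ Dt * Δ (x , y , z)
      det-transport≡DtΔ = trans det-transport (cong (Dt *_) (det-frame-Δ x y z))

    count-sends : ∀ b → b ∈ orderedTriples → count (λ g → sends? g b) SL2 ≡ 2 Nat.* indicator (square? (Dt * Δ b))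
    count-sends b@(x , y , z) b∈ with square? (Dt * Δ b)
    ... | yes square   = count-square (subst IsSquare (sym det-transport≡DtΔ) square)
      where open SendersOf (proj₂ (∈-orderedTriples⁻ b b∈))
    ... | no nonsquare = count-nonsquare (nonsquare ∘ subst IsSquare det-transport≡DtΔ)
      where open SendersOf (proj₂ (∈-orderedTriples⁻ b b∈))

    count-containing : count (λ g → T ⊆? image g B) SL2 ≡ 2 Nat.* count (λ b → square? (Dt * Δ b)) orderedTriples
    count-containing = begin
      count (λ g → T ⊆? image g B) SL2                             ≡⟨ count≡∑ _ SL2 ⟩
      ∑ (λ g → indicator (T ⊆? image g B)) SL2                     ≡⟨ ∑-cong SL2 contains≡count-sends ⟩
      ∑ (λ g → count (sends? g) orderedTriples) SL2                ≡⟨ ∑-count-comm sends? SL2 orderedTriples ⟩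
      ∑ (λ b → count (λ g → sends? g b) SL2) orderedTriples        ≡⟨ ∑-cong orderedTriples count-sends ⟩
      ∑ (λ b → 2 Nat.* indicator (square? (Dt * Δ b))) orderedTriples
                                                                   ≡⟨ ∑-cong orderedTriples (λ b _ → ℕP.*-comm 2 (indicator (square? (Dt * Δ b)))) ⟩
      ∑ (λ b → indicator (square? (Dt * Δ b)) Nat.* 2) orderedTriples
                                                                   ≡⟨ ∑-*ʳ 2 _ orderedTriples ⟩
      ∑ (λ b → indicator (square? (Dt * Δ b))) orderedTriples Nat.* 2
                                                                   ≡⟨ cong (Nat._* 2) (sym (count≡∑ _ orderedTriples)) ⟩
      count (λ b → square? (Dt * Δ b)) orderedTriples Nat.* 2      ≡⟨ ℕP.*-comm (count (λ b → square? (Dt * Δ b)) orderedTriples) 2 ⟩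
      2 Nat.* count (λ b → square? (Dt * Δ b)) orderedTriples      ∎
      where open ≡-Reasoning

  I : Mat
  I = scalar 1#

  det-I : det I ≡ 1#
  det-I = solve 0 (:1 :* :1 :- :0 :* :0 := :1) refl

  ∈-image-⊙ : ∀ h g p → det h ≢ 0# → det g ≢ 0# → p ∈ˢ image (h ⊙ g) B ⇔ act (adj h) p ∈ˢ image g B
  ∈-image-⊙ h g p h≢0 g≢0 = mk⇔ to from
    where
    to : p ∈ˢ image (h ⊙ g) B → act (adj h) p ∈ˢ image g B
    to p∈ with ∈-image⁻ (h ⊙ g) p p∈
    ... | x , x∈B , hgx≡p = ∈-image⁺ g _ x x∈B (begin
      act g (suc x)                       ≡⟨ sym (act-adj-act h _ h≢0) ⟩
      act (adj h) (act h (act g (suc x))) ≡⟨ cong (act (adj h)) (sym (act-⊙ h g (suc x) g≢0)) ⟩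
      act (adj h) (act (h ⊙ g) (suc x))   ≡⟨ cong (act (adj h)) hgx≡p ⟩
      act (adj h) p                       ∎)
      where open ≡-Reasoning
    from : act (adj h) p ∈ˢ image g B → p ∈ˢ image (h ⊙ g) B
    from p∈ with ∈-image⁻ g _ p∈
    ... | x , x∈B , gx≡ = ∈-image⁺ (h ⊙ g) p x x∈B (begin
      act (h ⊙ g) (suc x)     ≡⟨ act-⊙ h g (suc x) g≢0 ⟩
      act h (act g (suc x))   ≡⟨ cong (act h) gx≡ ⟩
      act h (act (adj h) p)   ≡⟨ act-act-adj h p h≢0 ⟩
      p                       ∎)
      where open ≡-Reasoning

  ∈-image⇔∈-image-⊙ : ∀ h g p → det h ≢ 0# → det g ≢ 0# → p ∈ˢ image g B ⇔ act h p ∈ˢ image (h ⊙ g) B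
  ∈-image⇔∈-image-⊙ h g p h≢0 g≢0 = mk⇔
    (λ p∈ → Equivalence.from (∈-image-⊙ h g (act h p) h≢0 g≢0) (subst (_∈ˢ image g B) (sym (act-adj-act h p h≢0)) p∈))
    (λ hp∈ → subst (_∈ˢ image g B) (act-adj-act h p h≢0) (Equivalence.to (∈-image-⊙ h g (act h p) h≢0 g≢0) hp∈))

  image-⊙-≡⇔ : ∀ h g g′ → det h ≢ 0# → det g ≢ 0# → det g′ ≢ 0# →
    image (h ⊙ g) B ≡ image (h ⊙ g′) B ⇔ image g B ≡ image g′ B
  image-⊙-≡⇔ h g g′ h≢0 g≢0 g′≢0 =
    mk⇔ (λ eq → ⊆-antisym (cancel g g′ g≢0 g′≢0 eq) (cancel g′ g g′≢0 g≢0 (sym eq)))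
        (λ eq → ⊆-antisym (translate g g′ g≢0 g′≢0 eq) (translate g′ g g′≢0 g≢0 (sym eq)))
    where
    cancel : ∀ m m′ → det m ≢ 0# → det m′ ≢ 0# → image (h ⊙ m) B ≡ image (h ⊙ m′) B → image m B ⊆ image m′ B
    cancel m m′ m≢0 m′≢0 eq {p} p∈ = Equivalence.from (∈-image⇔∈-image-⊙ h m′ p h≢0 m′≢0)
      (subst (act h p ∈ˢ_) eq (Equivalence.to (∈-image⇔∈-image-⊙ h m p h≢0 m≢0) p∈))
    translate : ∀ m m′ → det m ≢ 0# → det m′ ≢ 0# → image m B ≡ image m′ B → image (h ⊙ m) B ⊆ image (h ⊙ m′) B
    translate m m′ m≢0 m′≢0 eq {p} p∈ = Equivalence.from (∈-image-⊙ h m′ p h≢0 m′≢0)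
      (subst (act (adj h) p ∈ˢ_) eq (Equivalence.to (∈-image-⊙ h m p h≢0 m≢0) p∈))

  _≟ˢ_ : DecidableEquality (Subset (suc q))
  _≟ˢ_ = VecP.≡-dec BoolP._≟_

  stabiliser : ℕ
  stabiliser = count (λ g → image g B ≟ˢ image I B) SL2

  stabiliser>0 : 0 Nat.< stabiliser
  stabiliser>0 = ∃⇒count>0 (λ g → image g B ≟ˢ image I B) SL2 (∈-SL2⁺ I det-I) refl

  -- Left multiplication by h is a bijection of SL(2,q) taking the stabiliser of B onto {g | g B = h B}.
  count-orbit-fibre : ∀ D → D ∈ blocks B → count (λ g → image g B ≟ˢ D) SL2 ≡ stabiliser
  count-orbit-fibre D D∈ with ∈-map⁻ (λ g → image g B) (∈-deduplicate⁻ _≟ˢ_ (map (λ g → image g B) SL2) D∈)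
  ... | h , h∈ , refl = begin
    count (λ g → image g B ≟ˢ image h B) SL2              ≡⟨ sym (count-∘-bijection _ SL2 SL2-unique (h ⊙_) h⊙-injective h⊙∈ h⊙-onto) ⟩
    count (λ g → image (h ⊙ g) B ≟ˢ image h B) SL2        ≡⟨ count-cong _ _ SL2 (λ g g∈ → stabilises g g∈) ⟩
    count (λ g → image g B ≟ˢ image I B) SL2              ∎
    where
    open ≡-Reasoning
    h≢0 = SL2-det-≢0 h h∈
    det-h≡1 = ∈-SL2⁻ h h∈
    stabilises : ∀ g → g ∈ SL2 → (image (h ⊙ g) B ≡ image h B) ⇔ (image g B ≡ image I B)
    stabilises g g∈ = subst (λ k → (image (h ⊙ g) B ≡ image k B) ⇔ _) (⊙-identityʳ h)
      (image-⊙-≡⇔ h g I h≢0 (SL2-det-≢0 g g∈) (λ det≡0 → 1≢0 (trans (sym det-I) det≡0)))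
    unscale : ∀ m → scale (det h) m ≡ m
    unscale m = trans (cong (λ k → scale k m) det-h≡1) (scale-1 m)
    h⊙-injective : ∀ {g g′} → h ⊙ g ≡ h ⊙ g′ → g ≡ g′
    h⊙-injective {g} {g′} eq = begin
      g                      ≡⟨ sym (unscale g) ⟩
      scale (det h) g        ≡⟨ sym (adj-⊙-cancel h g) ⟩
      adj h ⊙ (h ⊙ g)        ≡⟨ cong (adj h ⊙_) eq ⟩
      adj h ⊙ (h ⊙ g′)       ≡⟨ adj-⊙-cancel h g′ ⟩
      scale (det h) g′       ≡⟨ unscale g′ ⟩
      g′                     ∎
    h⊙∈ : ∀ g → g ∈ SL2 → h ⊙ g ∈ SL2
    h⊙∈ g g∈ = ∈-SL2⁺ _ (trans (det-⊙ h g) (trans (cong₂ _*_ det-h≡1 (∈-SL2⁻ g g∈)) (*-identityʳ 1#)))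
    h⊙-onto : ∀ g → g ∈ SL2 → ∃ λ g′ → g′ ∈ SL2 × h ⊙ g′ ≡ g
    h⊙-onto g g∈ = adj h ⊙ g , ∈-SL2⁺ _ (trans (det-⊙ (adj h) g) (trans (cong₂ _*_ (trans (det-adj h) det-h≡1) (∈-SL2⁻ g g∈)) (*-identityʳ 1#))) ,
                  trans (⊙-adj-cancel h g) (unscale g)

  count-SL2-containing : ∀ T → count (λ g → T ⊆? image g B) SL2 ≡ countContaining B T Nat.* stabiliser
  count-SL2-containing T = count-∘-constantFibres _≟ˢ_ (T ⊆?_) (λ g → image g B) SL2 (blocks B) (DecUniqueP.deduplicate-! _≟ˢ_ _)
    (λ g g∈ → ∈-deduplicate⁺ _≟ˢ_ (∈-map⁺ (λ g → image g B) g∈)) stabiliser count-orbit-fibre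

module Design {q : ℕ} (F : FiniteField q) (j : ℕ) (q≡1+4j : q ≡ suc (j Nat.* 4)) (B : Subset q) where

  open FieldArithmetic F
  open Matrices F
  open ThreeTransitivity F
  open QuadraticResidues F j q≡1+4j
  open TriplesOf B
  open BlockCounting F j q≡1+4j B
  open Counting

  square⇒-square : ∀ a → IsSquare a → IsSquare (- a)
  square⇒-square a a-sq = subst IsSquare (solve 1 (λ a → (:- :1) :* a := :- a) refl a) (square-* (- 1#) a -1-square a-sq)

  -square⇔square : ∀ a → IsSquare (- a) ⇔ IsSquare a
  -square⇔square a = mk⇔ (subst IsSquare (solve 1 (λ a → :- (:- a) := a) refl a) ∘ square⇒-square (- a)) (square⇒-square a)

  Δ-arrangement : ∀ s t → t ∈ arrangements s → Δ t ≡ Δ s ⊎ Δ t ≡ - Δ s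
  Δ-arrangement (x , y , z) _ (here refl) = inj₁ refl
  Δ-arrangement (x , y , z) _ (there (here refl)) = inj₁ (solve 3 (λ x y z →
    (y :- z) :* (z :- x) :* (x :- y) := (x :- y) :* (y :- z) :* (z :- x)) refl x y z)
  Δ-arrangement (x , y , z) _ (there (there (here refl))) = inj₁ (solve 3 (λ x y z →
    (z :- x) :* (x :- y) :* (y :- z) := (x :- y) :* (y :- z) :* (z :- x)) refl x y z)
  Δ-arrangement (x , y , z) _ (there (there (there (here refl)))) = inj₂ (solve 3 (λ x y z →
    (y :- x) :* (x :- z) :* (z :- y) := :- ((x :- y) :* (y :- z) :* (z :- x))) refl x y z)
  Δ-arrangement (x , y , z) _ (there (there (there (there (here refl))))) = inj₂ (solve 3 (λ x y z →
    (x :- z) :* (z :- y) :* (y :- x) := :- ((x :- y) :* (y :- z) :* (z :- x))) refl x y z)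
  Δ-arrangement (x , y , z) _ (there (there (there (there (there (here refl)))))) = inj₂ (solve 3 (λ x y z →
    (z :- y) :* (y :- x) :* (x :- z) := :- ((x :- y) :* (y :- z) :* (z :- x))) refl x y z)

  -- −1 is a square, as q ≡ 1 (mod 4).
  square-Δ-arrangement : ∀ s t → t ∈ arrangements s → IsSquare (Δ t) ⇔ IsSquare (Δ s)
  square-Δ-arrangement s t t∈ with Δ-arrangement s t t∈
  ... | inj₁ Δt≡Δs  = subst (λ d → IsSquare d ⇔ IsSquare (Δ s)) (sym Δt≡Δs) (mk⇔ (λ sq → sq) (λ sq → sq))
  ... | inj₂ Δt≡-Δs = subst (λ d → IsSquare d ⇔ IsSquare (Δ s)) (sym Δt≡-Δs) (-square⇔square (Δ s))

  N⁺ N⁻ : ℕ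
  N⁺ = count (square? ∘ Δ) sortedTriples
  N⁻ = count (¬? ∘ square? ∘ Δ) sortedTriples

  tripleSum≡N⁺-N⁻ : tripleSum B ≡ ℤ.+ N⁺ ℤ.- ℤ.+ N⁻
  tripleSum≡N⁺-N⁻ = begin
    tripleSum B                                             ≡⟨ cong (foldr ℤ._+_ 0ℤ) (sym map-χ-Δ) ⟩
    foldr ℤ._+_ 0ℤ (map χ (map Δ sortedTriples))            ≡⟨ ∑χ (map Δ sortedTriples) Δ-≢0-sorted ⟩
    ℤ.+ count square? (map Δ sortedTriples) ℤ.- ℤ.+ count (¬? ∘ square?) (map Δ sortedTriples)
                                                            ≡⟨ cong₂ (λ m n → ℤ.+ m ℤ.- ℤ.+ n) (count-map square? Δ sortedTriples) (count-map (¬? ∘ square?) Δ sortedTriples) ⟩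
    ℤ.+ N⁺ ℤ.- ℤ.+ N⁻                                       ∎
    where
    open ≡-Reasoning
    Δ-≢0-sorted : ∀ d → d ∈ map Δ sortedTriples → d ≢ 0#
    Δ-≢0-sorted d d∈ with ∈-map⁻ Δ d∈
    ... | s , s∈ , refl = Δ-≢0 s (proj₂ (Sorted⇒Distinct s (∈-sortedTriples⁻ s s∈)))
    map-χ-Δ : map χ (map Δ sortedTriples) ≡
      concatMap (λ x → concatMap (λ y → map (λ z → χ ((x - y) * (y - z) * (z - x))) (thirds x y)) (seconds x)) firsts
    map-χ-Δ = begin
      map χ (map Δ sortedTriples)   ≡⟨ sym (ListP.map-∘ sortedTriples) ⟩
      map (χ ∘ Δ) sortedTriples     ≡⟨ ListP.map-concatMap (χ ∘ Δ) _ firsts ⟩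
      concatMap (λ x → map (χ ∘ Δ) (concatMap (λ y → map (λ z → (x , y , z)) (thirds x y)) (seconds x))) firsts
                                    ≡⟨ ListP.concatMap-cong (λ x → trans (ListP.map-concatMap (χ ∘ Δ) _ (seconds x))
                                         (ListP.concatMap-cong (λ y → sym (ListP.map-∘ (thirds x y))) (seconds x))) firsts ⟩
      concatMap (λ x → concatMap (λ y → map (λ z → χ ((x - y) * (y - z) * (z - x))) (thirds x y)) (seconds x)) firsts
                                    ∎

  module _ {t₁ t₂ t₃ : Point} (dt : Distinct₃ t₁ t₂ t₃) where

    open Through dt

    Dt≢0 : Dt ≢ 0#
    Dt≢0 = det-frame-≢0 dt

    blocks-through-square : IsSquare Dt → countContaining B T Nat.* stabiliser ≡ 2 Nat.* (6 Nat.* N⁺)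
    blocks-through-square Dt-sq = begin
      countContaining B T Nat.* stabiliser                       ≡⟨ sym (count-SL2-containing T) ⟩
      count (λ g → T ⊆? image g B) SL2                           ≡⟨ count-containing ⟩
      2 Nat.* count (λ b → square? (Dt * Δ b)) orderedTriples    ≡⟨ cong (2 Nat.*_) (count-cong _ (square? ∘ Δ) orderedTriples (λ b _ → same-class b)) ⟩
      2 Nat.* count (square? ∘ Δ) orderedTriples                 ≡⟨ cong (2 Nat.*_) (count-orderedTriples (square? ∘ Δ) square-Δ-arrangement) ⟩
      2 Nat.* (6 Nat.* N⁺)                                       ∎
      where
      open ≡-Reasoning
      same-class : ∀ b → IsSquare (Dt * Δ b) ⇔ IsSquare (Δ b)
      same-class b = mk⇔ (square-cancelˡ Dt (Δ b) Dt≢0 Dt-sq) (square-* Dt (Δ b) Dt-sq)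

    blocks-through-nonsquare : ¬ IsSquare Dt → countContaining B T Nat.* stabiliser ≡ 2 Nat.* (6 Nat.* N⁻)
    blocks-through-nonsquare Dt-nonsq = begin
      countContaining B T Nat.* stabiliser                       ≡⟨ sym (count-SL2-containing T) ⟩
      count (λ g → T ⊆? image g B) SL2                           ≡⟨ count-containing ⟩
      2 Nat.* count (λ b → square? (Dt * Δ b)) orderedTriples    ≡⟨ cong (2 Nat.*_) (count-cong _ (¬? ∘ square? ∘ Δ) orderedTriples opposite-class) ⟩
      2 Nat.* count (¬? ∘ square? ∘ Δ) orderedTriples            ≡⟨ cong (2 Nat.*_) (count-orderedTriples (¬? ∘ square? ∘ Δ) non-square-Δ-arrangement) ⟩
      2 Nat.* (6 Nat.* N⁻)                                       ∎
      where
      open ≡-Reasoning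
      opposite-class : ∀ b → b ∈ orderedTriples → IsSquare (Dt * Δ b) ⇔ (¬ IsSquare (Δ b))
      opposite-class b b∈ = mk⇔
        (λ DtΔ-sq Δ-sq → Dt-nonsq (square-cancelˡ (Δ b) Dt Δ≢0 Δ-sq (subst IsSquare (*-comm Dt (Δ b)) DtΔ-sq)))
        (nonsquare-*-nonsquare Dt (Δ b) Dt≢0 Dt-nonsq Δ≢0)
        where
        Δ≢0 = Δ-≢0 b (proj₂ (∈-orderedTriples⁻ b b∈))
      non-square-Δ-arrangement : ∀ s t → t ∈ arrangements s → (¬ IsSquare (Δ t)) ⇔ (¬ IsSquare (Δ s))
      non-square-Δ-arrangement s t t∈ = mk⇔ (λ ¬sq sq → ¬sq (Equivalence.from (square-Δ-arrangement s t t∈) sq))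
                                            (λ ¬sq sq → ¬sq (Equivalence.to (square-Δ-arrangement s t t∈) sq))

  distinct-∞-0-y : ∀ y → y ≢ 0# → Distinct₃ ∞ (suc 0#) (suc y)
  distinct-∞-0-y y y≢0 = (λ ()) , (λ 0≡y → y≢0 (sym (suc-injective 0≡y))) , (λ ())

  det-frame-∞-0-y : ∀ y → det (frame ∞ (suc 0#) (suc y)) ≡ y
  det-frame-∞-0-y y = trans (det-frame ∞ (suc 0#) (suc y))
    (solve 1 (λ y → (:0 :* :0 :- :1 :* :1) :* (y :* :1 :- :0 :* :1) :* (y :* :0 :- :1 :* :1) := y) refl y)

  -- The triples {∞, 0, 1} and {∞, 0, n}, n a nonsquare, lie in blocks in the ratio N⁺ : N⁻.
  design⇒N⁺≡N⁻ : Gives3Design B → N⁺ ≡ N⁻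
  design⇒N⁺≡N⁻ (λ′ , _ , constant) = ℕP.*-cancelˡ-≡ N⁺ N⁻ 6 (ℕP.*-cancelˡ-≡ (6 Nat.* N⁺) (6 Nat.* N⁻) 2 (begin
    2 Nat.* (6 Nat.* N⁺)                                            ≡⟨ sym (blocks-through-square (distinct-∞-0-y 1# 1≢0) 1-square) ⟩
    countContaining B (triple ∞ (suc 0#) (suc 1#)) Nat.* stabiliser ≡⟨ cong (Nat._* stabiliser) (trans (through-∞-0 (distinct-∞-0-y 1# 1≢0))
                                                                                                      (sym (through-∞-0 (distinct-∞-0-y n n≢0)))) ⟩
    countContaining B (triple ∞ (suc 0#) (suc n)) Nat.* stabiliser  ≡⟨ blocks-through-nonsquare (distinct-∞-0-y n n≢0) n-nonsquare ⟩
    2 Nat.* (6 Nat.* N⁻)                                            ∎))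
    where
    open ≡-Reasoning
    n = proj₁ ∃nonsquare
    n≢0 = proj₁ (proj₂ ∃nonsquare)
    through-∞-0 : ∀ {y} → Distinct₃ ∞ (suc 0#) (suc y) → countContaining B (triple ∞ (suc 0#) (suc y)) ≡ λ′
    through-∞-0 (∞≢0 , 0≢y , ∞≢y) = constant ∞ (suc 0#) (suc _) ∞≢0 0≢y ∞≢y
    1-square : IsSquare (det (frame ∞ (suc 0#) (suc 1#)))
    1-square = 1# , trans (*-identityʳ 1#) (sym (det-frame-∞-0-y 1#))
    n-nonsquare : ¬ IsSquare (det (frame ∞ (suc 0#) (suc n)))
    n-nonsquare = proj₂ (proj₂ ∃nonsquare) ∘ subst IsSquare (det-frame-∞-0-y n)

  sortedTriples-nonempty : 3 Nat.≤ Subset.∣ B ∣ → 0 Nat.< length sortedTriples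
  sortedTriples-nonempty three with three-distinct elementsOfB (subst (3 Nat.≤_) (SubsetFacts.∣∣≡count B) three)
                                      (UniqueP.filter⁺ _ (UniqueP.allFin⁺ q))
  ... | x , y , z , x∈ , y∈ , z∈ , distinct with find (∈-concatMap⁻ arrangements {xs = sortedTriples}
                                                  (∈-orderedTriples⁺ x y z (∈-elementsOfB⁻ x∈ , ∈-elementsOfB⁻ y∈ , ∈-elementsOfB⁻ z∈) distinct))
  ...   | s , s∈ , _ = ∈⇒length>0 s∈

  N⁺≡N⁻⇒design : 3 Nat.≤ Subset.∣ B ∣ → N⁺ ≡ N⁻ → Gives3Design B
  N⁺≡N⁻⇒design three N⁺≡N⁻ = λ′ , λ′>0 , constant
    where
    open ≡-Reasoning
    instance
      stabiliser≢0 : Nat.NonZero stabiliser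
      stabiliser≢0 = Nat.>-nonZero stabiliser>0
    λ′ : ℕ
    λ′ = countContaining B (triple ∞ (suc 0#) (suc 1#))
    through : ∀ {t₁ t₂ t₃} → Distinct₃ t₁ t₂ t₃ → countContaining B (triple t₁ t₂ t₃) Nat.* stabiliser ≡ 2 Nat.* (6 Nat.* N⁺)
    through {t₁} {t₂} {t₃} dt with square? (det (frame t₁ t₂ t₃))
    ... | yes Dt-sq    = blocks-through-square dt Dt-sq
    ... | no Dt-nonsq  = trans (blocks-through-nonsquare dt Dt-nonsq) (cong (λ n → 2 Nat.* (6 Nat.* n)) (sym N⁺≡N⁻))
    constant : ∀ x y z → x ≢ y → y ≢ z → x ≢ z → countContaining B (triple x y z) ≡ λ′
    constant x y z x≢y y≢z x≢z = ℕP.*-cancelʳ-≡ _ _ stabiliser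
      (trans (through (x≢y , y≢z , x≢z)) (sym (through (distinct-∞-0-y 1# 1≢0))))
    N⁺>0 : 0 Nat.< N⁺
    N⁺>0 = ℕP.n≢0⇒n>0 λ N⁺≡0 → ℕP.<⇒≢ (sortedTriples-nonempty three) (begin
      0                      ≡⟨ cong₂ Nat._+_ (sym N⁺≡0) (sym (trans (sym N⁺≡N⁻) N⁺≡0)) ⟩
      N⁺ Nat.+ N⁻            ≡⟨ count+count¬≡length (square? ∘ Δ) sortedTriples ⟩
      length sortedTriples   ∎)
    λ′>0 : 0 Nat.< λ′
    λ′>0 = ℕP.n≢0⇒n>0 λ λ′≡0 → ℕP.<⇒≢ (ℕP.*-monoʳ-< 2 (ℕP.*-monoʳ-< 6 N⁺>0)) (begin
      0                                ≡⟨ cong (Nat._* stabiliser) (sym λ′≡0) ⟩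
      λ′ Nat.* stabiliser              ≡⟨ through (distinct-∞-0-y 1# 1≢0) ⟩
      2 Nat.* (6 Nat.* N⁺)             ∎)

  tripleSum≡0⇔N⁺≡N⁻ : tripleSum B ≡ 0ℤ ⇔ N⁺ ≡ N⁻
  tripleSum≡0⇔N⁺≡N⁻ = mk⇔
    (λ sum≡0 → ℤP.+-injective (ℤP.i-j≡0⇒i≡j (ℤ.+ N⁺) (ℤ.+ N⁻) (trans (sym tripleSum≡N⁺-N⁻) sum≡0)))
    (λ N⁺≡N⁻ → trans tripleSum≡N⁺-N⁻ (ℤP.i≡j⇒i-j≡0 (cong ℤ.+_ N⁺≡N⁻)))

open import Data.Nat using (_<_; _∸_; _*_; _%_)
open import Data.Nat.DivMod using (_/_; m≡m%n+[m/n]*n)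
open import Data.Fin.Subset using (∣_∣)

-- Only q ≡ 1 (mod 4) and |B| ≥ 3 are used: the equivalence holds for every subset B of F_q
-- with at least three elements.
lemma2p6 : (q : ℕ) (F : FiniteField q) → q % 4 ≡ 1 →
    (k : ℕ) → k ∣ q ∸ 1 → 3 < k → k < q ∸ 1 →
    (∀ m → q ∸ 1 ≡ m * k → 2 ∣ m) →
    (B : Subset q) → FF.IsSubgroupOfUnits F B → ∣ B ∣ ≡ k →
    (FF.Gives3Design F B ⇔ FF.tripleSum F B ≡ 0ℤ)
lemma2p6 q F q%4≡1 k _ 3<k _ _ B _ ∣B∣≡k =
  mk⇔ (Equivalence.from tripleSum≡0⇔N⁺≡N⁻ ∘ design⇒N⁺≡N⁻) (N⁺≡N⁻⇒design 3≤∣B∣ ∘ Equivalence.to tripleSum≡0⇔N⁺≡N⁻)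
  where
  q≡1+4j : q ≡ suc (q / 4 * 4)
  q≡1+4j = trans (m≡m%n+[m/n]*n q 4) (cong (Nat._+ q / 4 * 4) q%4≡1)
  open Design F (q / 4) q≡1+4j B
  3≤∣B∣ : 3 Nat.≤ ∣ B ∣
  3≤∣B∣ = ℕP.<⇒≤ (subst (3 <_) (sym ∣B∣≡k) 3<k)
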